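{- Let $n\ge0$ and $\pi\in S_n$. Then $\pi$ can be reduced to the empty permutation $\pi_\emptyset\in S_0$ by a finite sequence of reductions of type 1 and type 3 if and only if $\pi$ is the permutation induced by some noncrossing partition of $[n]$. In particular, there are exactly $C_n=\frac{(2n)!}{n!\,(n+1)!}$ such permutations in $S_n$.
   Context: $S_n$ is the symmetric group on $[n]=\{1,\dots,n\}$, and $S_0=\{\pi_\emptyset\}$. Reduction of type 1: if $n\ge1$, $\pi\in S_n$ and $\pi(i)=i$, the reduced permutation is $\pi_\emptyset$ if $n=1$, and for $n>1$ it is $\pi'\in S_{n-1}$ with $\pi'(j)=\psi(\pi(\sigma(j)))$, where $\sigma(j)=j$ for $j<i$, $\sigma(j)=j+1$ for $j\ge i$, and $\psi(k)=k$ for $k<i$, $\psi(k)=k-1$ for $k>i$. Reduction of type 3: if $n\ge1$, $\pi\in S_n$ and $\pi(i)\equiv i+1\pmod n$: if $i<n$ (so $\pi(i)=i+1$), the reduced permutation is $\pi'\in S_{n-1}$ with $\pi'(j)=\varphi(\pi(\sigma(j)))$, where $\sigma$ is as before and $\varphi(k)=k$ for $k\le i$, $\varphi(k)=k-1$ for $k>i+1$; if $i=n>1$ (so $\pi(n)=1$), the reduced permutation is $\pi'\in S_{n-1}$ with $\pi'(j)=\pi(j)$ for $j\in[n-1]$, $j\ne\pi^{ -1}(n)$, and $\pi'(\pi^{ -1}(n))=1$; if $i=n=1$, it is $\pi_\emptyset$. A partition of $[n]$ is noncrossing if there are no $p<q<p'<q'$ with $p,p'$ in one block and $q,q'$ in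 a different block. A noncrossing partition with blocks $\{a_1<\dots<a_j\}$ induces the permutation sending $a_r\mapsto a_{r+1}$ for $r<j$ and $a_j\mapsto a_1$ on each block (for $n=0$ the empty partition induces $\pi_\emptyset$). -}

module Defs where

open import Data.Nat using (ℕ; zero; suc; _*_; _<_; _∸_; _<ᵇ_; _≤ᵇ_; _≡ᵇ_)
open import Data.Nat.Properties using (_!*_!≢0)
open import Data.Nat.DivMod using (_/_)
open import Data.Nat.Combinatorics using ()
open import Data.Nat.Base using (_!)
open import Data.Bool using (if_then_else_)
open import Data.Fin using (Fin; toℕ; fromℕ; inject₁; punchIn)
import Data.Fin as F
open import Data.Fin.Permutation using (Permutation′; _⟨$⟩ʳ_)
open import Data.Product using (Σ; ∃; ∃-syntax; _×_; _,_)
open import Data.Sum using (_⊎_)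
open import Data.List using (List; length)
open import Data.List.Relation.Unary.All using (All)
open import Data.List.Relation.Unary.Any using (Any)
open import Data.List.Relation.Unary.AllPairs using (AllPairs)
open import Relation.Binary.PropositionalEquality using (_≡_; _≢_)
open import Relation.Nullary using (¬_)

-- Conventions: [n] is represented by Fin n, 0-indexed (paper's element k is
-- Fin element k-1).  S_n is Permutation′ n (Fin n ↔ Fin n); S_0 = Permutation′ 0
-- has the single element π_∅.

val : ∀ {n} → Permutation′ n → Fin n → ℕ
val π j = toℕ (π ⟨$⟩ʳ j)

-- ψ_i(k) = k for k < i, k - 1 for k > i (the value k = i never occurs).
ψ : ℕ → ℕ → ℕ
ψ i k = if k <ᵇ i then k else k ∸ 1

-- φ_i(k) = k for k ≤ i, k - 1 for k > i+1 (the value k = i+1 never occurs).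
φ : ℕ → ℕ → ℕ
φ i k = if k ≤ᵇ i then k else k ∸ 1

-- σ_i(j) = j for j < i, j+1 for j ≥ i : this is exactly Data.Fin.punchIn i.

Type1 : ∀ {m} → Permutation′ (suc m) → Permutation′ m → Set
Type1 {m} π π' = Σ (Fin (suc m)) λ i →
  (val π i ≡ toℕ i) × (∀ (j : Fin m) → val π' j ≡ ψ (toℕ i) (val π (punchIn i j)))

-- Reduction of type 3 at i with i < n (0-indexed: i+1 < n and π(i) = i+1).
Type3a : ∀ {m} → Permutation′ (suc m) → Permutation′ m → Set
Type3a {m} π π' = Σ (Fin (suc m)) λ i →
  (suc (toℕ i) < suc m) × (val π i ≡ suc (toℕ i)) ×
  (∀ (j : Fin m) → val π' j ≡ φ (toℕ i) (val π (punchIn i j)))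

wrap : ℕ → ℕ → ℕ
wrap m k = if k ≡ᵇ m then 0 else k

-- Reduction of type 3 at i = n (π(n) = 1; 0-indexed: π(last) = 0).
-- For n = 1 the quantification over Fin 0 is vacuous and π' = π_∅.
Type3b : ∀ {m} → Permutation′ (suc m) → Permutation′ m → Set
Type3b {m} π π' =
  (val π (fromℕ m) ≡ 0) × (∀ (j : Fin m) → val π' j ≡ wrap m (val π (inject₁ j)))

Step : ∀ {m} → Permutation′ (suc m) → Permutation′ m → Set
Step π π' = Type1 π π' ⊎ Type3a π π' ⊎ Type3b π π'

data Reducible : ∀ {n} → Permutation′ n → Set where
  done : (π : Permutation′ 0) → Reducible π
  step : ∀ {m} (π : Permutation′ (suc m)) (π' : Permutation′ m) →
         Step π π' → Reducible π' → Reducible π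

-- A set partition of [n] given by a block-labelling: p and q lie in the same
-- block iff B p ≡ B q (every partition arises this way).
Partition : ℕ → Set
Partition n = Fin n → ℕ

NonCrossing : ∀ {n} → Partition n → Set
NonCrossing {n} B = ¬ (Σ (Fin n) λ p → Σ (Fin n) λ q → Σ (Fin n) λ p' → Σ (Fin n) λ q' →
  (p F.< q) × (q F.< p') × (p' F.< q') × (B p ≡ B p') × (B q ≡ B q') × (B p ≢ B q))

-- c is the image of a under the cyclic permutation of a's block
-- {a_1 < ... < a_j}: a_r ↦ a_{r+1}, a_j ↦ a_1.
IsNext : ∀ {n} → Partition n → Fin n → Fin n → Set
IsNext {n} B a c = (B c ≡ B a) ×
  ( (a F.< c × (∀ (b : Fin n) → a F.< b → b F.< c → B b ≢ B a))
  ⊎ (c F.≤ a × (∀ (b : Fin n) → a F.< b → B b ≢ B a) × (∀ (b : Fin n) → b F.< c → B b ≢ B a)))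

Induces : ∀ {n} → Partition n → Permutation′ n → Set
Induces {n} B π = ∀ (a : Fin n) → IsNext B a (π ⟨$⟩ʳ a)

NCInduced : ∀ {n} → Permutation′ n → Set
NCInduced {n} π = Σ (Partition n) λ B → NonCrossing B × Induces B π

catalan : ℕ → ℕ
catalan n = _/_ ((2 * n) !) (n ! * (suc n) !) {{n !* (suc n) !≢0}}

_≈ₚ_ : ∀ {n} → Permutation′ n → Permutation′ n → Set
_≈ₚ_ {n} π ρ = ∀ (i : Fin n) → π ⟨$⟩ʳ i ≡ ρ ⟨$⟩ʳ i

-- The number of permutations in S_n satisfying P is exactly k
-- (permutations counted up to pointwise equality).
HasCount : (n : ℕ) → (Permutation′ n → Set) → ℕ → Set
HasCount n P k = Σ (List (Permutation′ n)) λ L →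
  (length L ≡ k) × AllPairs (λ π ρ → ¬ (π ≈ₚ ρ)) L × All P L ×
  (∀ (π : Permutation′ n) → P π → Any (π ≈ₚ_) L)

module Submission where

-- The combinatorial core is a binary-tree decomposition.  For σ ∈ S_k and
-- τ ∈ S_m, glue σ τ ∈ S_{1+k+m} runs σ on the positions 1..k and τ on the
-- block-of-0 side 0, k+1, ..., k+m; every binary tree t thus yields a
-- permutation treePerm t.  The proof then has four parts:
--   1. every treePerm t is reducible, since type 1 and type 3a steps on σ
--      lift to steps on glue σ τ, and glue π_∅ τ reduces to τ in one step;
--   2. a reduction step reflects being noncrossing-induced, so every
--      reducible permutation is noncrossing-induced;
--   3. a noncrossing-induced permutation splits along the block of 0 as a
--      glue of two smaller noncrossing-induced ones, hence equals some
--      treePerm t and is reducible by part 1;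
--   4. treePerm is injective, and the trees with n nodes are enumerated as
--      forests whose counts satisfy a ballot-number formula, giving C_n.

open import Defs
open import Data.Nat
open import Data.Nat.Properties
open import Data.Nat.DivMod using (_/_; m*n/n≡m)
open import Data.Nat.Tactic.RingSolver using (solve-∀)
open import Data.Bool using (true; false; if_then_else_; T)
open import Data.Fin as F using (Fin; toℕ; fromℕ<; punchIn)
open import Data.Fin.Properties using (toℕ-injective; toℕ<n; toℕ-fromℕ<; fromℕ<-toℕ; toℕ-fromℕ; toℕ-inject₁)
open import Data.Fin.Permutation as Perm using (Permutation′; _⟨$⟩ʳ_; permutation; inverseˡ; inverseʳ; flip)
open import Data.Product using (Σ; _×_; _,_; proj₁; proj₂)
open import Data.Sum using (_⊎_; inj₁; inj₂)
open import Data.Empty using (⊥; ⊥-elim)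
open import Data.Vec using (Vec; []; _∷_)
open import Data.List using (List; []; _∷_; map; _++_; length; [_])
open import Data.List.Properties using (length-map; length-++)
open import Data.List.Relation.Unary.All as All using (All; []; _∷_)
import Data.List.Relation.Unary.All.Properties as AllP
open import Data.List.Relation.Unary.Any as Any using (Any; here)
import Data.List.Relation.Unary.Any.Properties as AnyP
open import Data.List.Relation.Unary.AllPairs as AP using (AllPairs; []; _∷_)
import Data.List.Relation.Unary.AllPairs.Properties as APP
open import Data.List.Membership.Propositional using (_∈_)
open import Data.List.Membership.Propositional.Properties using (∈-map⁺; ∈-map⁻; ∈-++⁺ˡ; ∈-++⁺ʳ)
open import Data.List.Relation.Unary.Unique.Propositional using (Unique)
import Data.List.Relation.Unary.Unique.Propositional.Properties as UP
open import Function using (case_of_)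
open import Function.Bundles using (_⇔_; mk⇔)
open import Relation.Nullary using (¬_; yes; no)
open import Relation.Binary.PropositionalEquality hiding ([_])
open import Relation.Binary.Definitions using (Tri; tri<; tri≈; tri>)

T⇒≡true : ∀ {b} → T b → b ≡ true
T⇒≡true {true} _ = refl

¬T⇒≡false : ∀ {b} → ¬ T b → b ≡ false
¬T⇒≡false {false} _ = refl
¬T⇒≡false {true} h = ⊥-elim (h _)

module _ {A : Set} {a b : A} where
  if< : ∀ {x y} → x < y → (if x <ᵇ y then a else b) ≡ a
  if< p rewrite T⇒≡true (<⇒<ᵇ p) = refl
  if≮ : ∀ {x y} → y ≤ x → (if x <ᵇ y then a else b) ≡ b
  if≮ {x} {y} p rewrite ¬T⇒≡false {x <ᵇ y} (λ t → <⇒≱ (<ᵇ⇒< x y t) p) = refl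
  if≤ : ∀ {x y} → x ≤ y → (if x ≤ᵇ y then a else b) ≡ a
  if≤ p rewrite T⇒≡true (≤⇒≤ᵇ p) = refl
  if≰ : ∀ {x y} → y < x → (if x ≤ᵇ y then a else b) ≡ b
  if≰ {x} {y} p rewrite ¬T⇒≡false {x ≤ᵇ y} (λ t → <⇒≱ p (≤ᵇ⇒≤ x y t)) = refl
  if≡ : ∀ {x y} → x ≡ y → (if x ≡ᵇ y then a else b) ≡ a
  if≡ {x} {y} p rewrite T⇒≡true (≡⇒≡ᵇ x y p) = refl
  if≢ : ∀ {x y} → x ≢ y → (if x ≡ᵇ y then a else b) ≡ b
  if≢ {x} {y} p rewrite ¬T⇒≡false {x ≡ᵇ y} (λ t → p (≡ᵇ⇒≡ x y t)) = refl

punchInℕ : ℕ → ℕ → ℕ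
punchInℕ i j = if j <ᵇ i then j else suc j

punchInℕ-below : ∀ {i j} → j < i → punchInℕ i j ≡ j
punchInℕ-below = if<

punchInℕ-above : ∀ {i j} → i ≤ j → punchInℕ i j ≡ suc j
punchInℕ-above = if≮

toℕ-punchIn : ∀ {n} (i : Fin (suc n)) (j : Fin n) → toℕ (punchIn i j) ≡ punchInℕ (toℕ i) (toℕ j)
toℕ-punchIn F.zero j = sym (punchInℕ-above z≤n)
toℕ-punchIn (F.suc i) F.zero = refl
toℕ-punchIn (F.suc i) (F.suc j) with toℕ j <? toℕ i
... | yes p = trans (cong suc (trans (toℕ-punchIn i j) (punchInℕ-below p))) (sym (punchInℕ-below (s≤s p)))
... | no p = trans (cong suc (trans (toℕ-punchIn i j) (punchInℕ-above (≮⇒≥ p)))) (sym (punchInℕ-above (s≤s (≮⇒≥ p))))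

⟦_⟧ : ∀ {n} → Permutation′ n → ℕ → ℕ
⟦_⟧ {n} π x with x <? n
... | yes p = toℕ (π ⟨$⟩ʳ fromℕ< p)
... | no _ = x

⟦⟧-fromℕ< : ∀ {n} (π : Permutation′ n) x (p : x < n) → ⟦ π ⟧ x ≡ val π (fromℕ< p)
⟦⟧-fromℕ< {n} π x p with x <? n
... | yes q = refl
... | no q = ⊥-elim (q p)

⟦⟧-toℕ : ∀ {n} (π : Permutation′ n) (i : Fin n) → ⟦ π ⟧ (toℕ i) ≡ val π i
⟦⟧-toℕ π i = trans (⟦⟧-fromℕ< π (toℕ i) (toℕ<n i)) (cong (val π) (fromℕ<-toℕ i (toℕ<n i)))

⟦⟧-< : ∀ {n} (π : Permutation′ n) {x} → x < n → ⟦ π ⟧ x < n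
⟦⟧-< π {x} p rewrite ⟦⟧-fromℕ< π x p = toℕ<n _

⟦⟧-punchIn : ∀ {n} (π : Permutation′ (suc n)) (i : Fin (suc n)) (j : Fin n) →
             ⟦ π ⟧ (punchInℕ (toℕ i) (toℕ j)) ≡ val π (punchIn i j)
⟦⟧-punchIn π i j = trans (cong ⟦ π ⟧ (sym (toℕ-punchIn i j))) (⟦⟧-toℕ π (punchIn i j))

-- A permutation of [0,n) given by a function on ℕ and its inverse; this is
-- the form in which permutations are built from pieces in part 3.
record NatPerm (n : ℕ) : Set where
  field
    f g : ℕ → ℕ
    f< : ∀ {x} → x < n → f x < n
    g< : ∀ {x} → x < n → g x < n
    gf : ∀ {x} → x < n → g (f x) ≡ x
    fg : ∀ {x} → x < n → f (g x) ≡ x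
open NatPerm public

natPerm-injective : ∀ {n} (r : NatPerm n) {x y} → x < n → y < n → f r x ≡ f r y → x ≡ y
natPerm-injective r p q e = trans (sym (gf r p)) (trans (cong (g r) e) (gf r q))

toNatPerm : ∀ {n} → Permutation′ n → NatPerm n
toNatPerm {n} π = record { f = ⟦ π ⟧ ; g = ⟦ flip π ⟧ ; f< = ⟦⟧-< π ; g< = ⟦⟧-< (flip π)
  ; gf = λ {x} p → trans (cong ⟦ flip π ⟧ (⟦⟧-fromℕ< π x p))
                    (trans (⟦⟧-toℕ (flip π) _) (trans (cong toℕ (inverseˡ π)) (toℕ-fromℕ< p)))
  ; fg = λ {x} p → trans (cong ⟦ π ⟧ (⟦⟧-fromℕ< (flip π) x p))
                    (trans (⟦⟧-toℕ π _) (trans (cong toℕ (inverseʳ π)) (toℕ-fromℕ< p))) }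

⟦⟧-injective : ∀ {n} (π : Permutation′ n) {x y} → x < n → y < n → ⟦ π ⟧ x ≡ ⟦ π ⟧ y → x ≡ y
⟦⟧-injective π = natPerm-injective (toNatPerm π)

fromNatPerm : ∀ {n} → NatPerm n → Permutation′ n
fromNatPerm {n} r = permutation to from to∘from from∘to
  where
  to from : Fin n → Fin n
  to i = fromℕ< (f< r (toℕ<n i))
  from i = fromℕ< (g< r (toℕ<n i))
  to∘from : ∀ y → to (from y) ≡ y
  to∘from y = toℕ-injective (trans (toℕ-fromℕ< _) (trans (cong (f r) (toℕ-fromℕ< _)) (fg r (toℕ<n y))))
  from∘to : ∀ y → from (to y) ≡ y
  from∘to y = toℕ-injective (trans (toℕ-fromℕ< _) (trans (cong (g r) (toℕ-fromℕ< _)) (gf r (toℕ<n y))))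

⟦⟧-fromNatPerm : ∀ {n} (r : NatPerm n) x → x < n → ⟦ fromNatPerm r ⟧ x ≡ f r x
⟦⟧-fromNatPerm r x p = trans (⟦⟧-fromℕ< (fromNatPerm r) x p) (trans (toℕ-fromℕ< _) (cong (f r) (toℕ-fromℕ< p)))

Type1ℕ : ∀ {m} → Permutation′ (suc m) → Permutation′ m → ℕ → Set
Type1ℕ {m} π π' i = i < suc m × ⟦ π ⟧ i ≡ i × (∀ j → j < m → ⟦ π' ⟧ j ≡ ψ i (⟦ π ⟧ (punchInℕ i j)))

Type3aℕ : ∀ {m} → Permutation′ (suc m) → Permutation′ m → ℕ → Set
Type3aℕ {m} π π' i = suc i < suc m × ⟦ π ⟧ i ≡ suc i × (∀ j → j < m → ⟦ π' ⟧ j ≡ φ i (⟦ π ⟧ (punchInℕ i j)))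

Type3bℕ : ∀ {m} → Permutation′ (suc m) → Permutation′ m → Set
Type3bℕ {m} π π' = ⟦ π ⟧ m ≡ 0 × (∀ j → j < m → ⟦ π' ⟧ j ≡ wrap m (⟦ π ⟧ j))

module _ {m} {π : Permutation′ (suc m)} {π' : Permutation′ m} where

  type1⇒ℕ : Type1 π π' → Σ ℕ (Type1ℕ π π')
  type1⇒ℕ (i , e , h) = toℕ i , toℕ<n i , trans (⟦⟧-toℕ π i) e , λ j p →
    trans (⟦⟧-fromℕ< π' j p) (trans (h (fromℕ< p))
      (cong (ψ (toℕ i)) (sym (trans (cong (λ z → ⟦ π ⟧ (punchInℕ (toℕ i) z)) (sym (toℕ-fromℕ< p)))
                                     (⟦⟧-punchIn π i (fromℕ< p))))))

  type1⇐ℕ : ∀ i → Type1ℕ π π' i → Type1 π π'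
  type1⇐ℕ i (p , e , h) = fromℕ< p , trans (sym (⟦⟧-fromℕ< π i p)) (trans e (sym (toℕ-fromℕ< p))) , λ j →
    trans (sym (⟦⟧-toℕ π' j)) (trans (h (toℕ j) (toℕ<n j))
      (trans (cong (λ z → ψ z (⟦ π ⟧ (punchInℕ z (toℕ j)))) (sym (toℕ-fromℕ< p)))
             (cong (ψ (toℕ (fromℕ< p))) (⟦⟧-punchIn π (fromℕ< p) j))))

  type3a⇒ℕ : Type3a π π' → Σ ℕ (Type3aℕ π π')
  type3a⇒ℕ (i , q , e , h) = toℕ i , q , trans (⟦⟧-toℕ π i) e , λ j p →
    trans (⟦⟧-fromℕ< π' j p) (trans (h (fromℕ< p))
      (cong (φ (toℕ i)) (sym (trans (cong (λ z → ⟦ π ⟧ (punchInℕ (toℕ i) z)) (sym (toℕ-fromℕ< p)))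
                                     (⟦⟧-punchIn π i (fromℕ< p))))))

  type3a⇐ℕ : ∀ i → Type3aℕ π π' i → Type3a π π'
  type3a⇐ℕ i (q , e , h) = fromℕ< p , subst (λ z → suc z < suc m) (sym (toℕ-fromℕ< p)) q ,
    trans (sym (⟦⟧-fromℕ< π i p)) (trans e (cong suc (sym (toℕ-fromℕ< p)))) , λ j →
    trans (sym (⟦⟧-toℕ π' j)) (trans (h (toℕ j) (toℕ<n j))
      (trans (cong (λ z → φ z (⟦ π ⟧ (punchInℕ z (toℕ j)))) (sym (toℕ-fromℕ< p)))
             (cong (φ (toℕ (fromℕ< p))) (⟦⟧-punchIn π (fromℕ< p) j))))
    where p = <-trans (n<1+n i) q

  type3b⇒ℕ : Type3b π π' → Type3bℕ π π'
  type3b⇒ℕ (e , h) = trans (cong ⟦ π ⟧ (sym (toℕ-fromℕ m))) (trans (⟦⟧-toℕ π _) e) , λ j p →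
    trans (⟦⟧-fromℕ< π' j p) (trans (h (fromℕ< p)) (cong (wrap m)
      (trans (sym (⟦⟧-toℕ π _)) (cong ⟦ π ⟧ (trans (toℕ-inject₁ _) (toℕ-fromℕ< p))))))

  type3b⇐ℕ : Type3bℕ π π' → Type3b π π'
  type3b⇐ℕ (e , h) = trans (sym (⟦⟧-toℕ π _)) (trans (cong ⟦ π ⟧ (toℕ-fromℕ m)) e) , λ j →
    trans (sym (⟦⟧-toℕ π' j)) (trans (h (toℕ j) (toℕ<n j)) (cong (wrap m)
      (trans (cong ⟦ π ⟧ (sym (toℕ-inject₁ j))) (⟦⟧-toℕ π _))))

-- For σ ∈ S_k and τ ∈ S_m the permutation glue σ τ ∈ S_{1+k+m}
-- sends 0 ↦ k+1 (or 0 ↦ 0 when m = 0), 1+x ↦ 1+σ(x) for x < k, and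
-- k+1+z ↦ outer k (τ z): the value 0 of τ is read as the position 0, so
-- the block of 0 is {0, k+1, ...} and σ lives strictly inside it.
outer : ℕ → ℕ → ℕ
outer k zero = zero
outer k (suc y) = suc (suc y + k)

glueℕ : ℕ → ℕ → (ℕ → ℕ) → (ℕ → ℕ) → ℕ → ℕ
glueℕ k m s t zero = openBlock m
  where openBlock : ℕ → ℕ
        openBlock zero = zero
        openBlock (suc _) = suc k
glueℕ k m s t (suc x) = if x <ᵇ k then suc (s x) else outer k (t (x ∸ k))

glueℕ⁻¹ : ℕ → ℕ → (ℕ → ℕ) → (ℕ → ℕ) → ℕ → ℕ
glueℕ⁻¹ k m s t zero = closeBlock m
  where closeBlock : ℕ → ℕ
        closeBlock zero = zero
        closeBlock (suc _) = suc (k + t 0)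
glueℕ⁻¹ k m s t (suc x) = if x <ᵇ k then suc (s x) else (if x ≡ᵇ k then 0 else suc (k + t (x ∸ k)))

data Position (k x : ℕ) : Set where
  below : x < k → Position k x
  beyond : ∀ z → x ≡ k + z → Position k x

position : ∀ k x → Position k x
position zero x = beyond x refl
position (suc k) zero = below z<s
position (suc k) (suc x) with position k x
... | below p = below (s<s p)
... | beyond z e = beyond z (cong suc e)

module _ {k m : ℕ} {s t : ℕ → ℕ} where
  glueℕ-inner : ∀ {x} → x < k → glueℕ k m s t (suc x) ≡ suc (s x)
  glueℕ-inner = if<

  glueℕ-outer : ∀ z → glueℕ k m s t (suc (k + z)) ≡ outer k (t z)
  glueℕ-outer z = trans (if≮ (m≤m+n k z)) (cong (λ w → outer k (t w)) (m+n∸m≡n k z))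

  glueℕ⁻¹-inner : ∀ {x} → x < k → glueℕ⁻¹ k m s t (suc x) ≡ suc (s x)
  glueℕ⁻¹-inner = if<

  glueℕ⁻¹-closing : glueℕ⁻¹ k m s t (suc k) ≡ 0
  glueℕ⁻¹-closing = trans (if≮ {x = k} {y = k} ≤-refl) (if≡ {x = k} {y = k} refl)

  glueℕ⁻¹-outer : ∀ z → glueℕ⁻¹ k m s t (suc (k + suc z)) ≡ suc (k + t (suc z))
  glueℕ⁻¹-outer z = trans (if≮ (<⇒≤ k<k+1+z)) (trans (if≢ (λ e → <⇒≢ k<k+1+z (sym e)))
                      (cong (λ w → suc (k + t w)) (m+n∸m≡n k (suc z))))
    where k<k+1+z = ≤-trans (s≤s (m≤m+n k z)) (≤-reflexive (sym (+-suc k z)))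

outer-bounded : ∀ k m y → y < m → outer k y < suc (k + m)
outer-bounded k m zero p = z<s
outer-bounded k m (suc y) p = s≤s (subst (_< k + m) (+-comm k (suc y)) (+-monoʳ-< k p))

suc-+-cancel-< : ∀ k {a b} → suc (k + a) < suc (k + b) → a < b
suc-+-cancel-< k p = +-cancelˡ-< k _ _ (s<s⁻¹ p)

-- glueℕ and glueℕ⁻¹ are mutually inverse bijections of [0, 1+k+m).  The
-- statements about position 0 are generalised over m', since glueℕ
-- computes on position 0 by cases on the size of τ.
module GlueInverse {k m : ℕ} (σ : NatPerm k) (τ : NatPerm m) where
  fwd bwd : ℕ → ℕ
  fwd = glueℕ k m (f σ) (f τ)
  bwd = glueℕ⁻¹ k m (g σ) (g τ)

  fwd-bounded-0 : ∀ m' (t : ℕ → ℕ) → glueℕ k m' (f σ) t 0 < suc (k + m')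
  fwd-bounded-0 zero t = z<s
  fwd-bounded-0 (suc m') t = s<s (m<m+n k z<s)

  fwd-bounded : ∀ {x} → x < suc (k + m) → fwd x < suc (k + m)
  fwd-bounded {zero} p = fwd-bounded-0 m (f τ)
  fwd-bounded {suc x} p with position k x
  ... | below q rewrite glueℕ-inner {k} {m} {f σ} {f τ} q = s<s (≤-trans (f< σ q) (m≤m+n k m))
  ... | beyond z refl rewrite glueℕ-outer {k} {m} {f σ} {f τ} z = outer-bounded k m (f τ z) (f< τ (suc-+-cancel-< k p))

  bwd-bounded-0 : ∀ m' (t : ℕ → ℕ) → (0 < m' → t 0 < m') → glueℕ⁻¹ k m' (g σ) t 0 < suc (k + m')
  bwd-bounded-0 zero t h = z<s
  bwd-bounded-0 (suc m') t h = s<s (+-monoʳ-< k (h z<s))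

  bwd-bounded : ∀ {x} → x < suc (k + m) → bwd x < suc (k + m)
  bwd-bounded {zero} p = bwd-bounded-0 m (g τ) (g< τ)
  bwd-bounded {suc x} p with position k x
  ... | below q rewrite glueℕ⁻¹-inner {k} {m} {g σ} {g τ} q = s<s (≤-trans (g< σ q) (m≤m+n k m))
  ... | beyond zero refl rewrite +-identityʳ k | glueℕ⁻¹-closing {k} {m} {g σ} {g τ} = z<s
  ... | beyond (suc z) refl rewrite glueℕ⁻¹-outer {k} {m} {g σ} {g τ} z = s<s (+-monoʳ-< k (g< τ (suc-+-cancel-< k p)))

  bwd∘fwd-0 : ∀ m' (s t : ℕ → ℕ) → glueℕ⁻¹ k m' (g σ) t (glueℕ k m' (f σ) s 0) ≡ 0
  bwd∘fwd-0 zero s t = refl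
  bwd∘fwd-0 (suc m') s t = glueℕ⁻¹-closing {k} {suc m'} {g σ} {t}

  bwd-0 : ∀ m' (t : ℕ → ℕ) → 0 < m' → glueℕ⁻¹ k m' (g σ) t 0 ≡ suc (k + t 0)
  bwd-0 (suc m') t _ = refl

  bwd∘fwd : ∀ {x} → x < suc (k + m) → bwd (fwd x) ≡ x
  bwd∘fwd {zero} p = bwd∘fwd-0 m (f τ) (g τ)
  bwd∘fwd {suc x} p with position k x
  ... | below q rewrite glueℕ-inner {k} {m} {f σ} {f τ} q | glueℕ⁻¹-inner {k} {m} {g σ} {g τ} (f< σ q) = cong suc (gf σ q)
  ... | beyond z refl rewrite glueℕ-outer {k} {m} {f σ} {f τ} z = bwd-outer (f τ z) refl
    where
    z<m = suc-+-cancel-< k p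
    bwd-outer : ∀ y → f τ z ≡ y → bwd (outer k y) ≡ suc (k + z)
    bwd-outer zero e = trans (bwd-0 m (g τ) (≤-trans (s≤s z≤n) z<m))
      (cong (λ w → suc (k + w)) (trans (cong (g τ) (sym e)) (gf τ z<m)))
    bwd-outer (suc y) e rewrite +-comm (suc y) k | glueℕ⁻¹-outer {k} {m} {g σ} {g τ} y =
      cong (λ w → suc (k + w)) (trans (cong (g τ) (sym e)) (gf τ z<m))

  fwd∘bwd-0 : ∀ m' (s t : ℕ → ℕ) → (0 < m' → s (t 0) ≡ 0) → glueℕ k m' (f σ) s (glueℕ⁻¹ k m' (g σ) t 0) ≡ 0
  fwd∘bwd-0 zero s t h = refl
  fwd∘bwd-0 (suc m') s t h rewrite glueℕ-outer {k} {suc m'} {f σ} {s} (t 0) | h z<s = refl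

  fwd-0 : ∀ m' (s : ℕ → ℕ) → 0 < m' → glueℕ k m' (f σ) s 0 ≡ suc k
  fwd-0 (suc m') _ _ = refl

  fwd∘bwd : ∀ {x} → x < suc (k + m) → fwd (bwd x) ≡ x
  fwd∘bwd {zero} p = fwd∘bwd-0 m (f τ) (g τ) (fg τ)
  fwd∘bwd {suc x} p with position k x
  ... | below q rewrite glueℕ⁻¹-inner {k} {m} {g σ} {g τ} q | glueℕ-inner {k} {m} {f σ} {f τ} (g< σ q) = cong suc (fg σ q)
  ... | beyond zero refl rewrite +-identityʳ k | glueℕ⁻¹-closing {k} {m} {g σ} {g τ} =
        fwd-0 m (f τ) (suc-+-cancel-< k (subst (λ w → suc w < suc (k + m)) (sym (+-identityʳ k)) p))
  ... | beyond (suc z) refl rewrite glueℕ⁻¹-outer {k} {m} {g σ} {g τ} z | glueℕ-outer {k} {m} {f σ} {f τ} (g τ (suc z))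
        | fg τ (suc-+-cancel-< k p) = cong suc (+-comm (suc z) k)

glueNatPerm : ∀ {k m} → NatPerm k → NatPerm m → NatPerm (suc (k + m))
glueNatPerm σ τ = record { f = fwd ; g = bwd ; f< = fwd-bounded ; g< = bwd-bounded ; gf = bwd∘fwd ; fg = fwd∘bwd }
  where open GlueInverse σ τ

glue : ∀ {k m} → Permutation′ k → Permutation′ m → Permutation′ (suc (k + m))
glue σ τ = fromNatPerm (glueNatPerm (toNatPerm σ) (toNatPerm τ))

⟦⟧-glue : ∀ {k m} (σ : Permutation′ k) (τ : Permutation′ m) x → x < suc (k + m) →
          ⟦ glue σ τ ⟧ x ≡ glueℕ k m ⟦ σ ⟧ ⟦ τ ⟧ x
⟦⟧-glue σ τ x p = ⟦⟧-fromNatPerm (glueNatPerm (toNatPerm σ) (toNatPerm τ)) x p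

punchInℕ-skips : ∀ i j → punchInℕ i j ≢ i
punchInℕ-skips i j e with j <? i
... | yes p = <⇒≢ p (trans (sym (punchInℕ-below p)) e)
... | no p = <⇒≢ (≤-trans (s≤s (≮⇒≥ p)) (≤-reflexive (trans (sym (punchInℕ-above (≮⇒≥ p))) e))) refl

punchInℕ-bounded : ∀ {n} i j → j < n → punchInℕ i j < suc n
punchInℕ-bounded i j p with j <? i
... | yes q rewrite punchInℕ-below q = <-trans p (n<1+n _)
... | no q rewrite punchInℕ-above (≮⇒≥ q) = s<s p

punchInℕ-suc : ∀ i j → punchInℕ (suc i) (suc j) ≡ suc (punchInℕ i j)
punchInℕ-suc i j with j <? i
... | yes q rewrite punchInℕ-below q | punchInℕ-below (s<s q) = refl
... | no q rewrite punchInℕ-above (≮⇒≥ q) | punchInℕ-above (s≤s (≮⇒≥ q)) = refl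

ψ-below : ∀ {i v} → v < i → ψ i v ≡ v
ψ-below = if<

ψ-above : ∀ {i v} → i ≤ v → ψ i v ≡ v ∸ 1
ψ-above = if≮

φ-below : ∀ {i v} → v ≤ i → φ i v ≡ v
φ-below = if≤

φ-above : ∀ {i v} → i < v → φ i v ≡ v ∸ 1
φ-above = if≰

ψ-suc : ∀ i v → v ≢ i → ψ (suc i) (suc v) ≡ suc (ψ i v)
ψ-suc i v v≢i with v <? i
... | yes q rewrite ψ-below q | ψ-below (s<s q) = refl
... | no q rewrite ψ-above (≮⇒≥ q) | ψ-above (s≤s (≮⇒≥ q)) =
      sym (suc-pred v {{>-nonZero (≤-<-trans z≤n (≤∧≢⇒< (≮⇒≥ q) (λ e → v≢i (sym e))))}})

φ-suc : ∀ i v → φ (suc i) (suc v) ≡ suc (φ i v)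
φ-suc i v with v ≤? i
... | yes q rewrite φ-below q | φ-below (s≤s q) = refl
... | no q rewrite φ-above (≰⇒> q) | φ-above (s<s (≰⇒> q)) = sym (suc-pred v {{>-nonZero (≤-<-trans z≤n (≰⇒> q))}})

ψ-outer : ∀ i k y → i ≤ k → ψ (suc i) (outer (suc k) y) ≡ outer k y
ψ-outer i k zero p = refl
ψ-outer i k (suc y) p rewrite ψ-above {suc i} {suc (suc y + suc k)} (s≤s (≤-trans p (≤-trans (n≤1+n k) (m≤n+m (suc k) (suc y))))) =
  cong suc (+-suc y k)

φ-outer : ∀ i k y → i ≤ k → φ (suc i) (outer (suc k) y) ≡ outer k y
φ-outer i k zero p = refl
φ-outer i k (suc y) p rewrite φ-above {suc i} {suc (suc y + suc k)} (s<s (≤-trans (s≤s p) (m≤n+m (suc k) (suc y)))) =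
  cong suc (+-suc y k)

φ0-outer : ∀ y → φ 0 (outer 0 y) ≡ y
φ0-outer zero = refl
φ0-outer (suc y) = cong suc (+-identityʳ y)

module _ {k m : ℕ} (σ : Permutation′ (suc k)) (σ' : Permutation′ k) (τ : Permutation′ m) where
  type1-glue : ∀ i → Type1ℕ σ σ' i → Type1ℕ (glue σ τ) (glue σ' τ) (suc i)
  type1-glue i (i<1+k , σi≡i , reduced) = i+1<n ,
      trans (⟦⟧-glue σ τ (suc i) i+1<n) (trans (glueℕ-inner {suc k} {m} {⟦ σ ⟧} {⟦ τ ⟧} i<1+k) (cong suc σi≡i)) ,
      λ j q → trans (⟦⟧-glue σ' τ j q) (trans (pointwise j q) (cong (ψ (suc i)) (sym (⟦⟧-glue σ τ _ (punchInℕ-bounded (suc i) j q)))))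
    where
    i+1<n = s<s (≤-trans i<1+k (s≤s (m≤m+n k m)))
    at0 : ∀ m' → glueℕ k m' ⟦ σ' ⟧ ⟦ τ ⟧ 0 ≡ ψ (suc i) (glueℕ (suc k) m' ⟦ σ ⟧ ⟦ τ ⟧ 0)
    at0 zero = refl
    at0 (suc m') = sym (ψ-above (≤-trans i<1+k (n≤1+n _)))
    pointwise : ∀ j → j < suc (k + m) → glueℕ k m ⟦ σ' ⟧ ⟦ τ ⟧ j ≡ ψ (suc i) (glueℕ (suc k) m ⟦ σ ⟧ ⟦ τ ⟧ (punchInℕ (suc i) j))
    pointwise zero q = at0 m
    pointwise (suc j) q rewrite punchInℕ-suc i j with position k j
    ... | below r rewrite glueℕ-inner {k} {m} {⟦ σ' ⟧} {⟦ τ ⟧} r | glueℕ-inner {suc k} {m} {⟦ σ ⟧} {⟦ τ ⟧} (punchInℕ-bounded i j r)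
        = trans (cong suc (reduced j r)) (sym (ψ-suc i (⟦ σ ⟧ (punchInℕ i j))
            (λ e → punchInℕ-skips i j (⟦⟧-injective σ (punchInℕ-bounded i j r) i<1+k (trans e (sym σi≡i))))))
    ... | beyond z refl rewrite punchInℕ-above {i} {k + z} (≤-trans (s≤s⁻¹ i<1+k) (m≤m+n k z))
        | glueℕ-outer {k} {m} {⟦ σ' ⟧} {⟦ τ ⟧} z | glueℕ-outer {suc k} {m} {⟦ σ ⟧} {⟦ τ ⟧} z = sym (ψ-outer i k _ (s≤s⁻¹ i<1+k))

  type3a-glue : ∀ i → Type3aℕ σ σ' i → Type3aℕ (glue σ τ) (glue σ' τ) (suc i)
  type3a-glue i (i+1<1+k , σi≡i+1 , reduced) = s<s (≤-trans i+1<1+k (s≤s (m≤m+n k m))) ,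
      trans (⟦⟧-glue σ τ (suc i) i+1<n) (trans (glueℕ-inner {suc k} {m} {⟦ σ ⟧} {⟦ τ ⟧} i<1+k) (cong suc σi≡i+1)) ,
      λ j q → trans (⟦⟧-glue σ' τ j q) (trans (pointwise j q) (cong (φ (suc i)) (sym (⟦⟧-glue σ τ _ (punchInℕ-bounded (suc i) j q)))))
    where
    i<1+k = <-trans (n<1+n i) i+1<1+k
    i+1<n = s<s (≤-trans i<1+k (s≤s (m≤m+n k m)))
    at0 : ∀ m' → glueℕ k m' ⟦ σ' ⟧ ⟦ τ ⟧ 0 ≡ φ (suc i) (glueℕ (suc k) m' ⟦ σ ⟧ ⟦ τ ⟧ 0)
    at0 zero = refl
    at0 (suc m') = sym (φ-above (s<s i<1+k))
    pointwise : ∀ j → j < suc (k + m) → glueℕ k m ⟦ σ' ⟧ ⟦ τ ⟧ j ≡ φ (suc i) (glueℕ (suc k) m ⟦ σ ⟧ ⟦ τ ⟧ (punchInℕ (suc i) j))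
    pointwise zero q = at0 m
    pointwise (suc j) q rewrite punchInℕ-suc i j with position k j
    ... | below r rewrite glueℕ-inner {k} {m} {⟦ σ' ⟧} {⟦ τ ⟧} r | glueℕ-inner {suc k} {m} {⟦ σ ⟧} {⟦ τ ⟧} (punchInℕ-bounded i j r)
        = trans (cong suc (reduced j r)) (sym (φ-suc i (⟦ σ ⟧ (punchInℕ i j))))
    ... | beyond z refl rewrite punchInℕ-above {i} {k + z} (≤-trans (s≤s⁻¹ i<1+k) (m≤m+n k z))
        | glueℕ-outer {k} {m} {⟦ σ' ⟧} {⟦ τ ⟧} z | glueℕ-outer {suc k} {m} {⟦ σ ⟧} {⟦ τ ⟧} z = sym (φ-outer i k _ (s≤s⁻¹ i<1+k))

-- Once σ is empty, glue π_∅ τ reduces to τ at position 0: by type 1 if τ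
-- is empty (0 is fixed), by type 3a otherwise (0 ↦ 1).
type1-glue-empty : (σ τ : Permutation′ 0) → Type1ℕ (glue σ τ) τ 0
type1-glue-empty σ τ = z<s , ⟦⟧-glue σ τ 0 z<s , λ j ()

type3a-glue-empty : ∀ {m} (σ : Permutation′ 0) (τ : Permutation′ (suc m)) → Type3aℕ (glue σ τ) τ 0
type3a-glue-empty σ τ = s<s z<s , ⟦⟧-glue σ τ 0 z<s ,
  λ j q → sym (trans (cong (φ 0) (⟦⟧-glue σ τ (suc j) (s<s q))) (φ0-outer (⟦ τ ⟧ j)))

-- Reducibility using only type 1 and type 3a steps (the ones compatible
-- with gluing); it implies reducibility.
data Reducible₁₃ : ∀ {n} → Permutation′ n → Set where
  done₁₃ : (π : Permutation′ 0) → Reducible₁₃ π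
  step₁ : ∀ {m} (π : Permutation′ (suc m)) (π' : Permutation′ m) i → Type1ℕ π π' i → Reducible₁₃ π' → Reducible₁₃ π
  step₃ : ∀ {m} (π : Permutation′ (suc m)) (π' : Permutation′ m) i → Type3aℕ π π' i → Reducible₁₃ π' → Reducible₁₃ π

reducible₁₃⇒reducible : ∀ {n} {π : Permutation′ n} → Reducible₁₃ π → Reducible π
reducible₁₃⇒reducible (done₁₃ π) = done π
reducible₁₃⇒reducible (step₁ π π' i h r) = step π π' (inj₁ (type1⇐ℕ i h)) (reducible₁₃⇒reducible r)
reducible₁₃⇒reducible (step₃ π π' i h r) = step π π' (inj₂ (inj₁ (type3a⇐ℕ i h))) (reducible₁₃⇒reducible r)

reducible₁₃-glue : ∀ {k m} {σ : Permutation′ k} {τ : Permutation′ m} → Reducible₁₃ σ → Reducible₁₃ τ → Reducible₁₃ (glue σ τ)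
reducible₁₃-glue {m = zero} {τ = τ} (done₁₃ σ) rτ = step₁ (glue σ τ) τ 0 (type1-glue-empty σ τ) rτ
reducible₁₃-glue {m = suc m} {τ = τ} (done₁₃ σ) rτ = step₃ (glue σ τ) τ 0 (type3a-glue-empty σ τ) rτ
reducible₁₃-glue {τ = τ} (step₁ σ σ' i h r) rτ = step₁ (glue σ τ) (glue σ' τ) (suc i) (type1-glue σ σ' τ i h) (reducible₁₃-glue r rτ)
reducible₁₃-glue {τ = τ} (step₃ σ σ' i h r) rτ = step₃ (glue σ τ) (glue σ' τ) (suc i) (type3a-glue σ σ' τ i h) (reducible₁₃-glue r rτ)

data Tree : Set where
  leaf : Tree
  node : Tree → Tree → Tree

size : Tree → ℕ
size leaf = 0
size (node a b) = suc (size a + size b)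

emptyNatPerm : NatPerm 0
emptyNatPerm = record { f = λ x → x ; g = λ x → x ; f< = λ () ; g< = λ () ; gf = λ () ; fg = λ () }

treePerm : (t : Tree) → Permutation′ (size t)
treePerm leaf = fromNatPerm emptyNatPerm
treePerm (node a b) = glue (treePerm a) (treePerm b)

reducible₁₃-tree : ∀ t → Reducible₁₃ (treePerm t)
reducible₁₃-tree leaf = done₁₃ _
reducible₁₃-tree (node a b) = reducible₁₃-glue (reducible₁₃-tree a) (reducible₁₃-tree b)

reducible-resp : ∀ {n} {π ρ : Permutation′ n} → (∀ x → x < n → ⟦ π ⟧ x ≡ ⟦ ρ ⟧ x) → Reducible π → Reducible ρ
reducible-resp {ρ = ρ} h (done π) = done ρ
reducible-resp {suc m} {π} {ρ} h (step π π' (inj₁ s) r) with type1⇒ℕ {π = π} {π' = π'} s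
... | i , p , e , reduced = step ρ π' (inj₁ (type1⇐ℕ i (p , trans (sym (h i p)) e ,
      λ j q → trans (reduced j q) (cong (ψ i) (h _ (punchInℕ-bounded i j q)))))) r
reducible-resp {suc m} {π} {ρ} h (step π π' (inj₂ (inj₁ s)) r) with type3a⇒ℕ {π = π} {π' = π'} s
... | i , p , e , reduced = step ρ π' (inj₂ (inj₁ (type3a⇐ℕ i (p , trans (sym (h i (<-trans (n<1+n i) p))) e ,
      λ j q → trans (reduced j q) (cong (φ i) (h _ (punchInℕ-bounded i j q))))))) r
reducible-resp {suc m} {π} {ρ} h (step π π' (inj₂ (inj₂ s)) r) with type3b⇒ℕ {π = π} {π' = π'} s
... | e , reduced = step ρ π' (inj₂ (inj₂ (type3b⇐ℕ (trans (sym (h m (n<1+n m))) e ,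
      λ j q → trans (reduced j q) (cong (wrap m) (h j (<-trans q (n<1+n m)))))))) r

IsNextℕ : ℕ → (ℕ → ℕ) → ℕ → ℕ → Set
IsNextℕ n B a c = (B c ≡ B a) ×
  ((a < c × (∀ b → a < b → b < c → B b ≢ B a)) ⊎
   (c ≤ a × (∀ b → a < b → b < n → B b ≢ B a) × (∀ b → b < c → B b ≢ B a)))

NonCrossingℕ : ℕ → (ℕ → ℕ) → Set
NonCrossingℕ n B = ∀ p q p' q' → p < q → q < p' → p' < q' → q' < n → B p ≡ B p' → B q ≡ B q' → B p ≢ B q → ⊥

Inducesℕ : ℕ → (ℕ → ℕ) → (ℕ → ℕ) → Set
Inducesℕ n B f = ∀ a → a < n → IsNextℕ n B a (f a)

NCInducedℕ : ℕ → (ℕ → ℕ) → Set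
NCInducedℕ n f = Σ (ℕ → ℕ) λ B → NonCrossingℕ n B × Inducesℕ n B f

labelℕ : ∀ {n} → Partition n → ℕ → ℕ
labelℕ {n} B x with x <? n
... | yes p = B (fromℕ< p)
... | no _ = 0

labelℕ-fromℕ< : ∀ {n} (B : Partition n) x (p : x < n) → labelℕ B x ≡ B (fromℕ< p)
labelℕ-fromℕ< {n} B x p with x <? n
... | yes q = refl
... | no q = ⊥-elim (q p)

labelℕ-toℕ : ∀ {n} (B : Partition n) (i : Fin n) → labelℕ B (toℕ i) ≡ B i
labelℕ-toℕ B i = trans (labelℕ-fromℕ< B (toℕ i) (toℕ<n i)) (cong B (fromℕ<-toℕ i (toℕ<n i)))

<⇒toℕ< : ∀ {n x y} (p : x < n) (q : y < n) → x < y → toℕ (fromℕ< p) < toℕ (fromℕ< q)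
<⇒toℕ< p q = subst₂ _<_ (sym (toℕ-fromℕ< p)) (sym (toℕ-fromℕ< q))

noncrossing⇒ℕ : ∀ {n} (B : Partition n) → NonCrossing B → NonCrossingℕ n (labelℕ B)
noncrossing⇒ℕ B nc p q p' q' p<q q<p' p'<q' q'<n Bp≡Bp' Bq≡Bq' Bp≢Bq =
  nc (fromℕ< p<n , fromℕ< q<n , fromℕ< p'<n , fromℕ< q'<n ,
      <⇒toℕ< p<n q<n p<q , <⇒toℕ< q<n p'<n q<p' , <⇒toℕ< p'<n q'<n p'<q' ,
      trans (sym (labelℕ-fromℕ< B p p<n)) (trans Bp≡Bp' (labelℕ-fromℕ< B p' p'<n)) ,
      trans (sym (labelℕ-fromℕ< B q q<n)) (trans Bq≡Bq' (labelℕ-fromℕ< B q' q'<n)) ,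
      λ e → Bp≢Bq (trans (labelℕ-fromℕ< B p p<n) (trans e (sym (labelℕ-fromℕ< B q q<n)))))
  where
  p'<n = <-trans p'<q' q'<n
  q<n = <-trans q<p' p'<n
  p<n = <-trans p<q q<n

isNext⇒ℕ : ∀ {n} (π : Permutation′ n) (B : Partition n) a (a<n : a < n) →
           IsNext B (fromℕ< a<n) (π ⟨$⟩ʳ fromℕ< a<n) → IsNextℕ n (labelℕ B) a (⟦ π ⟧ a)
isNext⇒ℕ {n} π B a a<n (eB , next) = trans Bc (trans eB (sym Ba)) , transport next
  where
  c = π ⟨$⟩ʳ fromℕ< a<n
  πa≡c : ⟦ π ⟧ a ≡ toℕ c
  πa≡c = ⟦⟧-fromℕ< π a a<n
  Bc : labelℕ B (⟦ π ⟧ a) ≡ B c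
  Bc = trans (cong (labelℕ B) πa≡c) (labelℕ-toℕ B c)
  Ba : labelℕ B a ≡ B (fromℕ< a<n)
  Ba = labelℕ-fromℕ< B a a<n
  below-c : ∀ {b} → b < ⟦ π ⟧ a → b < n
  below-c b<c = <-trans b<c (subst (_< n) (sym πa≡c) (toℕ<n c))
  other : ∀ {b} (b<n : b < n) → B (fromℕ< b<n) ≢ B (fromℕ< a<n) → labelℕ B b ≢ labelℕ B a
  other {b} b<n ne e = ne (trans (sym (labelℕ-fromℕ< B b b<n)) (trans e Ba))
  transport : _ → _
  transport (inj₁ (a<c , between)) = inj₁ (subst₂ _<_ (toℕ-fromℕ< a<n) (sym πa≡c) a<c ,
    λ b a<b b<c → other (below-c b<c) (between (fromℕ< (below-c b<c)) (<⇒toℕ< a<n (below-c b<c) a<b)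
                                        (subst₂ _<_ (sym (toℕ-fromℕ< (below-c b<c))) πa≡c b<c)))
  transport (inj₂ (c≤a , after , before)) = inj₂ (subst₂ _≤_ (sym πa≡c) (toℕ-fromℕ< a<n) c≤a ,
    (λ b a<b b<n → other b<n (after (fromℕ< b<n) (<⇒toℕ< a<n b<n a<b))) ,
    (λ b b<c → other (below-c b<c) (before (fromℕ< (below-c b<c)) (subst₂ _<_ (sym (toℕ-fromℕ< (below-c b<c))) πa≡c b<c))))

ncInduced⇒ℕ : ∀ {n} (π : Permutation′ n) → NCInduced π → NCInducedℕ n ⟦ π ⟧
ncInduced⇒ℕ π (B , nc , ind) = labelℕ B , noncrossing⇒ℕ B nc , λ a a<n → isNext⇒ℕ π B a a<n (ind (fromℕ< a<n))

ncInducedℕ⇒ : ∀ {n} (π : Permutation′ n) → NCInducedℕ n ⟦ π ⟧ → NCInduced π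
ncInducedℕ⇒ {n} π (B , nc , ind) = (λ i → B (toℕ i)) ,
  (λ { (p , q , p' , q' , p<q , q<p' , p'<q' , e1 , e2 , ne) → nc (toℕ p) (toℕ q) (toℕ p') (toℕ q') p<q q<p' p'<q' (toℕ<n q') e1 e2 ne }) ,
  λ a → isNext a (ind (toℕ a) (toℕ<n a))
  where
  isNext : ∀ a → IsNextℕ n B (toℕ a) (⟦ π ⟧ (toℕ a)) → IsNext (λ i → B (toℕ i)) a (π ⟨$⟩ʳ a)
  isNext a (e , next) rewrite ⟦⟧-toℕ π a with next
  ... | inj₁ (lt , between) = e , inj₁ (lt , λ b → between (toℕ b))
  ... | inj₂ (le , after , before) = e , inj₂ (le , (λ b a<b → after (toℕ b) a<b (toℕ<n b)) , λ b → before (toℕ b))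

-- Order properties of σ_i, ψ_i, φ_i: the reduced permutation sees the
-- remaining points in the same relative order.
ψ-punchInℕ : ∀ i j → ψ i (punchInℕ i j) ≡ j
ψ-punchInℕ i j with j <? i
... | yes p rewrite punchInℕ-below p = ψ-below p
... | no p rewrite punchInℕ-above (≮⇒≥ p) = ψ-above (≤-trans (≮⇒≥ p) (n≤1+n j))

punchInℕ-ψ : ∀ i x → x ≢ i → punchInℕ i (ψ i x) ≡ x
punchInℕ-ψ i x ne with <-cmp x i
... | tri< a _ _ rewrite ψ-below a = punchInℕ-below a
... | tri≈ _ b _ = ⊥-elim (ne b)
... | tri> _ _ (s≤s c) rewrite ψ-above (≤-trans (n≤1+n i) (s≤s c)) = punchInℕ-above c

ψ<m : ∀ {i x m} → i < suc m → x < suc m → x ≢ i → ψ i x < m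
ψ<m {i} {x} {m} ip xp ne with <-cmp x i
... | tri< a _ _ rewrite ψ-below a = <-≤-trans a (s≤s⁻¹ ip)
... | tri≈ _ b _ = ⊥-elim (ne b)
... | tri> _ _ (s≤s c) rewrite ψ-above (≤-trans (n≤1+n i) (s≤s c)) = s≤s⁻¹ xp

ψ-mono : ∀ {i a b} → a < b → a ≢ i → b ≢ i → ψ i a < ψ i b
ψ-mono {i} {a} {b} ab na nb with <-cmp a i | <-cmp b i
... | tri< x _ _ | tri< y _ _ rewrite ψ-below x | ψ-below y = ab
... | tri< x _ _ | tri> _ _ (s≤s y) rewrite ψ-below x | ψ-above (≤-trans (n≤1+n i) (s≤s y)) = <-≤-trans x y
... | tri> _ _ x | tri< y _ _ = ⊥-elim (<-asym (<-trans y x) ab)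
... | tri> _ _ (s≤s x) | tri> _ _ (s≤s y) rewrite ψ-above (≤-trans (n≤1+n i) (s≤s x)) | ψ-above (≤-trans (n≤1+n i) (s≤s y)) = s≤s⁻¹ ab
... | tri≈ _ e _ | _ = ⊥-elim (na e)
... | _ | tri≈ _ e _ = ⊥-elim (nb e)

punchInℕ-mono-< : ∀ i {j c} → j < c → punchInℕ i j < punchInℕ i c
punchInℕ-mono-< i {j} {c} jc with j <? i | c <? i
... | yes x | yes y rewrite punchInℕ-below x | punchInℕ-below y = jc
... | yes x | no y rewrite punchInℕ-below x | punchInℕ-above (≮⇒≥ y) = <-trans jc (n<1+n c)
... | no x | yes y = ⊥-elim (x (<-trans jc y))
... | no x | no y rewrite punchInℕ-above (≮⇒≥ x) | punchInℕ-above (≮⇒≥ y) = s<s jc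

punchInℕ-mono-≤ : ∀ i {j c} → j ≤ c → punchInℕ i j ≤ punchInℕ i c
punchInℕ-mono-≤ i {j} {c} jc with m≤n⇒m<n∨m≡n jc
... | inj₁ lt = <⇒≤ (punchInℕ-mono-< i lt)
... | inj₂ refl = ≤-refl

<⇒≤∸1 : ∀ {i b} → i < b → i ≤ b ∸ 1
<⇒≤∸1 {b = suc b} (s≤s p) = p

∸1< : ∀ {x m} → 0 < x → x < suc m → x ∸ 1 < m
∸1< {suc x} _ (s≤s p) = p

suc-∸1 : ∀ {v} → v ≢ 0 → suc (v ∸ 1) ≡ v
suc-∸1 {zero} ne = ⊥-elim (ne refl)
suc-∸1 {suc v} ne = refl

φ-mono-≤ : ∀ {i a b} → a ≤ b → φ i a ≤ φ i b
φ-mono-≤ {i} {a} {b} ab with a ≤? i | b ≤? i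
... | yes x | yes y rewrite φ-below x | φ-below y = ab
... | yes x | no y rewrite φ-below x | φ-above (≰⇒> y) = ≤-trans x (<⇒≤∸1 (≰⇒> y))
... | no x | yes y = ⊥-elim (x (≤-trans ab y))
... | no x | no y rewrite φ-above (≰⇒> x) | φ-above (≰⇒> y) = ∸-monoˡ-≤ 1 ab

-- φ_i merges only the two points i and i+1.
φ-strict : ∀ {i a b} → a < b → (a ≢ i ⊎ b ≢ suc i) → φ i a < φ i b
φ-strict {i} {a} {b} ab h with a ≤? i | b ≤? i
... | yes x | yes y rewrite φ-below x | φ-below y = ab
... | no x | yes y = ⊥-elim (x (≤-trans (<⇒≤ ab) y))
... | no x | no y rewrite φ-above (≰⇒> x) | φ-above (≰⇒> y) = ∸-monoˡ-< ab (≤-trans (s≤s z≤n) (≰⇒> x))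
... | yes x | no y rewrite φ-below x | φ-above (≰⇒> y) with m≤n⇒m<n∨m≡n x | m≤n⇒m<n∨m≡n (≰⇒> y)
...   | inj₁ ai | _ = ≤-trans ai (<⇒≤∸1 (≰⇒> y))
...   | inj₂ ai | inj₁ bi = ≤-trans (s≤s (≤-reflexive ai)) (<⇒≤∸1 bi)
...   | inj₂ ai | inj₂ bi with h
...     | inj₁ na = ⊥-elim (na ai)
...     | inj₂ nb = ⊥-elim (nb (sym bi))

φ-strict-blocks : ∀ {i} (B' : ℕ → ℕ) {a b} → a < b → B' (φ i a) ≢ B' (φ i b) → φ i a < φ i b
φ-strict-blocks {i} B' {a} {b} ab ne with m≤n⇒m<n∨m≡n (φ-mono-≤ {i} (<⇒≤ ab))
... | inj₁ lt = lt
... | inj₂ e = ⊥-elim (ne (cong B' e))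

φ<m : ∀ {i x m} → suc i < suc m → x < suc m → φ i x < m
φ<m {i} {x} {m} ip xp with x ≤? i
... | yes a rewrite φ-below a = ≤-<-trans a (s≤s⁻¹ ip)
... | no a rewrite φ-above (≰⇒> a) = ∸1< (≤-trans (s≤s z≤n) (≰⇒> a)) xp

φ-punchInℕ : ∀ i y → φ i (punchInℕ (suc i) y) ≡ y
φ-punchInℕ i y with y <? suc i
... | yes p rewrite punchInℕ-below p = φ-below (s≤s⁻¹ p)
... | no p rewrite punchInℕ-above (≮⇒≥ p) = φ-above {i} {suc y} (s≤s (≤-trans (n≤1+n i) (≮⇒≥ p)))

punchInℕ-φ : ∀ i v → v ≢ suc i → punchInℕ (suc i) (φ i v) ≡ v
punchInℕ-φ i v ne with v ≤? i
... | yes p rewrite φ-below p = punchInℕ-below (s≤s p)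
... | no p rewrite φ-above (≰⇒> p) =
      trans (punchInℕ-above (<⇒≤∸1 (≤∧≢⇒< (≰⇒> p) (λ e → ne (sym e))))) (suc-∸1 (n>0⇒n≢0 (≤-<-trans z≤n (≰⇒> p))))

ψ≡φ : ∀ i x → x ≢ i → ψ i x ≡ φ i x
ψ≡φ i x ne with <-cmp x i
... | tri< a _ _ rewrite ψ-below a | φ-below (<⇒≤ a) = refl
... | tri≈ _ b _ = ⊥-elim (ne b)
... | tri> _ _ c rewrite ψ-above (<⇒≤ c) | φ-above c = refl

wrap-m : ∀ m → wrap m m ≡ 0
wrap-m m = if≡ {x = m} {y = m} refl

wrap-≢ : ∀ {m x} → x ≢ m → wrap m x ≡ x
wrap-≢ {m} {x} = if≢ {x = x} {y = m}

wrap-0 : ∀ m → wrap m 0 ≡ 0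
wrap-0 zero = refl
wrap-0 (suc m) = refl

-- Type 1 at the fixed point i: give i a fresh singleton block (label 0)
-- and every other point the (shifted) block of its image under ψ_i.
module Type1Step {m} (π : Permutation′ (suc m)) (π' : Permutation′ m) (i : ℕ)
    (i<1+m : i < suc m) (πi≡i : ⟦ π ⟧ i ≡ i) (reduced : ∀ j → j < m → ⟦ π' ⟧ j ≡ ψ i (⟦ π ⟧ (punchInℕ i j)))
    (B' : ℕ → ℕ) (nc' : NonCrossingℕ m B') (ind' : Inducesℕ m B' ⟦ π' ⟧) where
  B : ℕ → ℕ
  B x = if x ≡ᵇ i then 0 else suc (B' (ψ i x))

  B-i : B i ≡ 0
  B-i = if≡ {x = i} {y = i} refl

  B-≢i : ∀ {x} → x ≢ i → B x ≡ suc (B' (ψ i x))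
  B-≢i {x} = if≢ {x = x} {y = i}

  singleton-i : ∀ {x y} → B x ≡ B y → x ≡ i → y ≡ i
  singleton-i {x} {y} e refl with y ≟ i
  ... | yes q = q
  ... | no q with trans (sym B-i) (trans e (B-≢i q))
  ... | ()

  B-≢0 : ∀ {x} → x ≢ i → B x ≢ 0
  B-≢0 ne e with trans (sym (B-≢i ne)) e
  ... | ()

  π-avoids-i : ∀ {x} → x < suc m → x ≢ i → ⟦ π ⟧ x ≢ i
  π-avoids-i xp ne e = ne (⟦⟧-injective π xp i<1+m (trans e (sym πi≡i)))

  π-via-π′ : ∀ {x} → x < suc m → x ≢ i → ⟦ π ⟧ x ≡ punchInℕ i (⟦ π' ⟧ (ψ i x))
  π-via-π′ {x} xp ne = sym (trans (cong (punchInℕ i) (trans (reduced (ψ i x) (ψ<m i<1+m xp ne))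
                                                             (cong (λ z → ψ i (⟦ π ⟧ z)) (punchInℕ-ψ i x ne))))
                                  (punchInℕ-ψ i (⟦ π ⟧ x) (π-avoids-i xp ne)))

  -- A crossing of B avoids the singleton i, so ψ_i maps it to a crossing of B'.
  nc : NonCrossingℕ (suc m) B
  nc p q p' q' a b c d e1 e2 ne = nc' (ψ i p) (ψ i q) (ψ i p') (ψ i q')
       (ψ-mono a np nq) (ψ-mono b nq np') (ψ-mono c np' nq') (ψ<m i<1+m d nq')
       (suc-injective (trans (sym (B-≢i np)) (trans e1 (B-≢i np'))))
       (suc-injective (trans (sym (B-≢i nq)) (trans e2 (B-≢i nq'))))
       (λ e → ne (trans (B-≢i np) (trans (cong suc e) (sym (B-≢i nq)))))
    where
    np : p ≢ i
    np e = <⇒≢ (<-trans a b) (trans e (sym (singleton-i e1 e)))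
    np' : p' ≢ i
    np' e = <⇒≢ (<-trans a b) (trans (singleton-i (sym e1) e) (sym e))
    nq : q ≢ i
    nq e = <⇒≢ (<-trans b c) (trans e (sym (singleton-i e2 e)))
    nq' : q' ≢ i
    nq' e = <⇒≢ (<-trans b c) (trans (singleton-i (sym e2) e) (sym e))

  isNext-i : IsNextℕ (suc m) B i (⟦ π ⟧ i)
  isNext-i = cong B πi≡i , inj₂ (≤-reflexive πi≡i ,
    (λ b ab bn e → B-≢0 (λ be → <⇒≢ ab (sym be)) (trans e B-i)) ,
    (λ b bc e → B-≢0 (λ be → <⇒≢ bc (trans be (sym πi≡i))) (trans e B-i)))

  -- Away from i, σ_i is an order embedding carrying π' to π, so the
  -- successor of ψ_i a in its B'-block gives the successor of a in its B-block.
  isNext-≢i : ∀ a → a < suc m → a ≢ i → IsNextℕ (suc m) B a (⟦ π ⟧ a)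
  isNext-≢i a ap na = eB , transport (proj₂ (ind' j j<m))
    where
    j = ψ i a
    j<m = ψ<m i<1+m ap na
    c' = ⟦ π' ⟧ j
    fa : ⟦ π ⟧ a ≡ punchInℕ i c'
    fa = π-via-π′ ap na
    ncx : ⟦ π ⟧ a ≢ i
    ncx = π-avoids-i ap na
    ψc : ψ i (⟦ π ⟧ a) ≡ c'
    ψc = trans (cong (ψ i) fa) (ψ-punchInℕ i c')
    pa : punchInℕ i j ≡ a
    pa = punchInℕ-ψ i a na
    eB : B (⟦ π ⟧ a) ≡ B a
    eB = trans (B-≢i ncx) (trans (cong (λ z → suc (B' z)) ψc) (trans (cong suc (proj₁ (ind' j j<m))) (sym (B-≢i na))))
    other : ∀ b → (b ≢ i → B' (ψ i b) ≢ B' j) → B b ≢ B a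
    other b h e = case b ≟ i of λ where
      (yes refl) → B-≢0 na (trans (sym e) B-i)
      (no bi) → h bi (suc-injective (trans (sym (B-≢i bi)) (trans e (B-≢i na))))
    transport : _ → _
    transport (inj₁ (lt , btw)) = inj₁ (subst₂ _<_ pa (sym fa) (punchInℕ-mono-< i lt) ,
      λ b ab bc → other b λ bi → btw (ψ i b) (ψ-mono ab na bi) (subst (ψ i b <_) ψc (ψ-mono bc bi ncx)))
    transport (inj₂ (le , aft , bef)) = inj₂ (subst₂ _≤_ (sym fa) pa (punchInℕ-mono-≤ i le) ,
      (λ b ab bn → other b λ bi → aft (ψ i b) (ψ-mono ab na bi) (ψ<m i<1+m bn bi)) ,
      (λ b bc → other b λ bi → bef (ψ i b) (subst (ψ i b <_) ψc (ψ-mono bc bi ncx))))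

  ind : Inducesℕ (suc m) B ⟦ π ⟧
  ind a ap with a ≟ i
  ... | yes refl = isNext-i
  ... | no na = isNext-≢i a ap na

ncInduced-type1 : ∀ {m} (π : Permutation′ (suc m)) (π' : Permutation′ m) i → Type1ℕ π π' i → NCInducedℕ m ⟦ π' ⟧ → NCInducedℕ (suc m) ⟦ π ⟧
ncInduced-type1 π π' i (i<1+m , πi≡i , reduced) (B' , nc' , ind') = B , nc , ind
  where open Type1Step π π' i i<1+m πi≡i reduced B' nc' ind'

-- Type 3a at i, where π(i) = i+1: the block labels are pulled back along
-- φ_i, which merges i with i+1.
module Type3aStep {m} (π : Permutation′ (suc m)) (π' : Permutation′ m) (i : ℕ)
    (i+1<1+m : suc i < suc m) (πi≡i+1 : ⟦ π ⟧ i ≡ suc i) (reduced : ∀ j → j < m → ⟦ π' ⟧ j ≡ φ i (⟦ π ⟧ (punchInℕ i j)))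
    (B' : ℕ → ℕ) (nc' : NonCrossingℕ m B') (ind' : Inducesℕ m B' ⟦ π' ⟧) where
  i<1+m : i < suc m
  i<1+m = <-trans (n<1+n i) i+1<1+m

  B : ℕ → ℕ
  B x = B' (φ i x)

  π-avoids-i+1 : ∀ {x} → x < suc m → x ≢ i → ⟦ π ⟧ x ≢ suc i
  π-avoids-i+1 xp ne e = ne (⟦⟧-injective π xp i<1+m (trans e (sym πi≡i+1)))

  π-via-π′ : ∀ {x} → x < suc m → x ≢ i → ⟦ π ⟧ x ≡ punchInℕ (suc i) (⟦ π' ⟧ (φ i x))
  π-via-π′ {x} xp ne = sym (trans (cong (punchInℕ (suc i)) (trans (cong ⟦ π' ⟧ (sym (ψ≡φ i x ne)))
                                    (trans (reduced (ψ i x) (ψ<m i<1+m xp ne)) (cong (λ z → φ i (⟦ π ⟧ z)) (punchInℕ-ψ i x ne)))))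
                                  (punchInℕ-φ i (⟦ π ⟧ x) (π-avoids-i+1 xp ne)))

  -- φ_i is strictly monotone on points of different blocks, so a crossing
  -- of B maps to a crossing of B'.
  nc : NonCrossingℕ (suc m) B
  nc p q p' q' a b c d e1 e2 ne = nc' (φ i p) (φ i q) (φ i p') (φ i q')
       (φ-strict-blocks B' a ne) (φ-strict-blocks B' b (λ e → ne (trans e1 (sym e))))
       (φ-strict-blocks B' c (λ e → ne (trans e1 (trans e (sym e2)))))
       (φ<m i+1<1+m d) e1 e2 ne

  -- i and i+1 are adjacent in one block, so i+1 is the successor of i.
  isNext-i : IsNextℕ (suc m) B i (⟦ π ⟧ i)
  isNext-i rewrite πi≡i+1 = trans (cong B' (φ-above {i} {suc i} (n<1+n i))) (sym (cong B' (φ-below {i} {i} ≤-refl))) ,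
    inj₁ (n<1+n i , λ b ib bi → ⊥-elim (<⇒≱ ib (s≤s⁻¹ bi)))

  -- Away from i, successors in B' pull back along the monotone map φ_i.
  isNext-≢i : ∀ a → a < suc m → a ≢ i → IsNextℕ (suc m) B a (⟦ π ⟧ a)
  isNext-≢i a ap na = eB , transport (proj₂ (ind' j j<m))
    where
    j = φ i a
    j<m = φ<m i+1<1+m ap
    c' = ⟦ π' ⟧ j
    fn : ⟦ π ⟧ a ≢ suc i
    fn = π-avoids-i+1 ap na
    φc : φ i (⟦ π ⟧ a) ≡ c'
    φc = trans (cong (φ i) (π-via-π′ ap na)) (φ-punchInℕ i c')
    eB : B (⟦ π ⟧ a) ≡ B a
    eB = trans (cong B' φc) (proj₁ (ind' j j<m))
    transport : _ → _
    transport (inj₁ (lt , btw)) = inj₁ (≰⇒> (λ le → <⇒≱ lt (subst (_≤ j) φc (φ-mono-≤ le))) ,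
      λ b ab bc → btw (φ i b) (φ-strict ab (inj₁ na)) (subst (φ i b <_) φc (φ-strict bc (inj₂ fn))))
    transport (inj₂ (le , aft , bef)) = inj₂ (≮⇒≥ (λ lt → <⇒≱ (subst (j <_) φc (φ-strict lt (inj₁ na))) le) ,
      (λ b ab bn → aft (φ i b) (φ-strict ab (inj₁ na)) (φ<m i+1<1+m bn)) ,
      (λ b bc → bef (φ i b) (subst (φ i b <_) φc (φ-strict bc (inj₂ fn)))))

  ind : Inducesℕ (suc m) B ⟦ π ⟧
  ind a ap with a ≟ i
  ... | yes refl = isNext-i
  ... | no na = isNext-≢i a ap na

ncInduced-type3a : ∀ {m} (π : Permutation′ (suc m)) (π' : Permutation′ m) i → Type3aℕ π π' i → NCInducedℕ m ⟦ π' ⟧ → NCInducedℕ (suc m) ⟦ π ⟧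
ncInduced-type3a π π' i (i+1<1+m , πi≡i+1 , reduced) (B' , nc' , ind') = B , nc , ind
  where open Type3aStep π π' i i+1<1+m πi≡i+1 reduced B' nc' ind'

-- Type 3b, where π(last) = 0: the labels are pulled back along wrap m,
-- which merges the last point m with 0.
module Type3bStep {m} (π : Permutation′ (suc m)) (π' : Permutation′ m)
    (πm≡0 : ⟦ π ⟧ m ≡ 0) (reduced : ∀ j → j < m → ⟦ π' ⟧ j ≡ wrap m (⟦ π ⟧ j))
    (B' : ℕ → ℕ) (nc' : NonCrossingℕ m B') (ind' : Inducesℕ m B' ⟦ π' ⟧) where
  B : ℕ → ℕ
  B x = B' (wrap m x)

  B-below : ∀ {x} → x < m → B x ≡ B' x
  B-below xm = cong B' (wrap-≢ (<⇒≢ xm))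

  B-m : B m ≡ B' 0
  B-m = cong B' (wrap-m m)

  B-0 : B 0 ≡ B' 0
  B-0 = cong B' (wrap-0 m)

  -- A crossing ending at m becomes, after moving m to 0, a crossing of B'
  -- starting at 0; any other crossing is already one of B'.
  nc : NonCrossingℕ (suc m) B
  nc p q p' q' a b c d e1 e2 ne with q' ≟ m
  ... | no nq = nc' p q p' q' a b c q'm
        (trans (sym (B-below pm)) (trans e1 (B-below p'm))) (trans (sym (B-below qm)) (trans e2 (B-below q'm)))
        (λ e → ne (trans (B-below pm) (trans e (sym (B-below qm)))))
    where
    q'm = ≤∧≢⇒< (s≤s⁻¹ d) nq
    p'm = <-trans c q'm
    qm = <-trans b p'm
    pm = <-trans a qm
  ... | yes refl = nc' 0 p q p' p0 a b c (sym Bq≡0) (trans (sym (B-below pm)) (trans e1 (B-below c)))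
                     (λ e → ne (trans (B-below pm) (trans (sym e) (trans (sym Bq≡0) (sym (B-below qm))))))
    where
    qm = <-trans b c
    pm = <-trans a qm
    Bq≡0 : B' q ≡ B' 0
    Bq≡0 = trans (sym (B-below qm)) (trans e2 B-m)
    p0 : 0 < p
    p0 = n≢0⇒n>0 (λ e → ne (trans (cong B e) (trans B-0 (trans (sym Bq≡0) (sym (B-below qm))))))

  -- m is the last point of the block of 0, so its successor is 0.
  isNext-m : IsNextℕ (suc m) B m (⟦ π ⟧ m)
  isNext-m rewrite πm≡0 = trans B-0 (sym B-m) , inj₂ (z≤n , (λ b mb bn → ⊥-elim (<⇒≱ mb (s≤s⁻¹ bn))) , λ b ())

  module _ (a : ℕ) (a<m : a < m) where
    π'a≡ : ⟦ π' ⟧ a ≡ wrap m (⟦ π ⟧ a)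
    π'a≡ = reduced a a<m

    πa≢0 : ⟦ π ⟧ a ≢ 0
    πa≢0 e = <⇒≢ a<m (⟦⟧-injective π (<-trans a<m (n<1+n m)) (n<1+n m) (trans e (sym πm≡0)))

    -- If π a = m then π' a = 0 closes a's block in π', which in π
    -- continues to m.
    isNext-to-m : ⟦ π ⟧ a ≡ m → IsNextℕ (suc m) B a (⟦ π ⟧ a)
    isNext-to-m e rewrite e with ind' a a<m
    ... | (eB , inj₁ (lt , _)) = ⊥-elim (<⇒≱ (subst (a <_) (trans π'a≡ (trans (cong (wrap m) e) (wrap-m m))) lt) z≤n)
    ... | (eB , inj₂ (_ , aft , _)) =
          trans B-m (trans (cong B' (sym (trans π'a≡ (trans (cong (wrap m) e) (wrap-m m))))) (trans eB (sym (B-below a<m)))) ,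
          inj₁ (a<m , λ b ab bm ee → aft b ab bm (trans (sym (B-below bm)) (trans ee (B-below a<m))))

    -- Otherwise π and π' agree at a, and only the new point m (in the
    -- block of 0) has to be excluded from a's block.
    isNext-not-m : ⟦ π ⟧ a ≢ m → IsNextℕ (suc m) B a (⟦ π ⟧ a)
    isNext-not-m ne = trans (cong B (sym fc)) (trans (B-below c'm) (trans (proj₁ (ind' a a<m)) (sym (B-below a<m)))) ,
                      transport (proj₂ (ind' a a<m))
      where
      fc : ⟦ π' ⟧ a ≡ ⟦ π ⟧ a
      fc = trans π'a≡ (wrap-≢ ne)
      c'm : ⟦ π' ⟧ a < m
      c'm = ⟦⟧-< π' a<m
      bm : ∀ {b} → b < ⟦ π ⟧ a → b < m
      bm bc = <-trans bc (subst (_< m) fc c'm)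
      other : ∀ {b} (b<m : b < m) → B' b ≢ B' a → B b ≢ B a
      other b<m ne' ee = ne' (trans (sym (B-below b<m)) (trans ee (B-below a<m)))
      transport : _ → _
      transport (inj₁ (lt , btw)) = inj₁ (subst (a <_) fc lt ,
        λ b ab bc → other (bm bc) (btw b ab (subst (b <_) (sym fc) bc)))
      transport (inj₂ (le , aft , bef)) = inj₂ (subst (_≤ a) fc le ,
        (λ b ab bn ee → case b ≟ m of λ where
            (yes refl) → bef 0 (subst (0 <_) (sym fc) (n≢0⇒n>0 πa≢0)) (trans (sym B-m) (trans ee (B-below a<m)))
            (no nb) → other (≤∧≢⇒< (s≤s⁻¹ bn) nb) (aft b ab (≤∧≢⇒< (s≤s⁻¹ bn) nb)) ee) ,
        (λ b bc → other (bm bc) (bef b (subst (b <_) (sym fc) bc))))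

  ind : Inducesℕ (suc m) B ⟦ π ⟧
  ind a ap with a ≟ m | ⟦ π ⟧ a ≟ m
  ... | yes refl | _ = isNext-m
  ... | no na | yes e = isNext-to-m a (≤∧≢⇒< (s≤s⁻¹ ap) na) e
  ... | no na | no ne = isNext-not-m a (≤∧≢⇒< (s≤s⁻¹ ap) na) ne

ncInduced-type3b : ∀ {m} (π : Permutation′ (suc m)) (π' : Permutation′ m) → Type3bℕ π π' → NCInducedℕ m ⟦ π' ⟧ → NCInducedℕ (suc m) ⟦ π ⟧
ncInduced-type3b π π' (πm≡0 , reduced) (B' , nc' , ind') = B , nc , ind
  where open Type3bStep π π' πm≡0 reduced B' nc' ind'

reducible⇒ncInducedℕ : ∀ {n} {π : Permutation′ n} → Reducible π → NCInducedℕ n ⟦ π ⟧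
reducible⇒ncInducedℕ (done π) = (λ _ → 0) , (λ p q p' q' a b c ()) , λ a ()
reducible⇒ncInducedℕ (step π π' (inj₁ s) r) with type1⇒ℕ {π = π} {π' = π'} s
... | i , h = ncInduced-type1 π π' i h (reducible⇒ncInducedℕ r)
reducible⇒ncInducedℕ (step π π' (inj₂ (inj₁ s)) r) with type3a⇒ℕ {π = π} {π' = π'} s
... | i , h = ncInduced-type3a π π' i h (reducible⇒ncInducedℕ r)
reducible⇒ncInducedℕ (step π π' (inj₂ (inj₂ s)) r) = ncInduced-type3b π π' (type3b⇒ℕ {π = π} {π' = π'} s) (reducible⇒ncInducedℕ r)

-- If π(0) = k+1, the
-- block of 0 separates [1, k] (closed under π) from [k+1, n]; restricting
-- the partition to these windows gives σ and τ.  If π(0) = 0, τ is empty.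

noncrossing-window : ∀ {N K} d B → d + K ≤ N → NonCrossingℕ N B → NonCrossingℕ K (λ x → B (d + x))
noncrossing-window d B dK nc p q p' q' a b c e e1 e2 ne =
  nc (d + p) (d + q) (d + p') (d + q') (+-monoʳ-< d a) (+-monoʳ-< d b) (+-monoʳ-< d c)
     (≤-trans (+-monoʳ-< d e) dK) e1 e2 ne

isNext-window : ∀ {N K} d B a c → d + K ≤ N → IsNextℕ N B (d + a) (d + c) → IsNextℕ K (λ x → B (d + x)) a c
isNext-window d B a c dK (e , inj₁ (lt , btw)) = e , inj₁ (+-cancelˡ-< d _ _ lt , λ b ab bc → btw (d + b) (+-monoʳ-< d ab) (+-monoʳ-< d bc))
isNext-window d B a c dK (e , inj₂ (le , aft , bef)) = e , inj₂ (+-cancelˡ-≤ d _ _ le ,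
  (λ b ab bK → aft (d + b) (+-monoʳ-< d ab) (≤-trans (+-monoʳ-< d bK) dK)) , λ b bc → bef (d + b) (+-monoʳ-< d bc))

outer⁻¹ : ℕ → ℕ → ℕ
outer⁻¹ k zero = zero
outer⁻¹ k (suc v) = v ∸ k

record Decomposition (n : ℕ) (π : ℕ → ℕ) : Set where
  field
    k m : ℕ
    k+m≡n : k + m ≡ n
    σ : NatPerm k
    τ : NatPerm m
    ncσ : NCInducedℕ k (f σ)
    ncτ : NCInducedℕ m (f τ)
    matches : ∀ x → x < suc n → π x ≡ glueℕ k m (f σ) (f τ) x

-- If π(0) = 0 then {0} is a block and π is π shifted down on [1, n].
module FixedZero {n} (r : NatPerm (suc n)) (B : ℕ → ℕ) (nc : NonCrossingℕ (suc n) B) (ind : Inducesℕ (suc n) B (f r)) (f0 : f r 0 ≡ 0) where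
  f-suc≢0 : ∀ {x} → x < n → f r (suc x) ≢ 0
  f-suc≢0 xp e with natPerm-injective r (s<s xp) z<s (trans e (sym f0))
  ... | ()

  g-suc≢0 : ∀ {x} → x < n → g r (suc x) ≢ 0
  g-suc≢0 xp e with trans (sym (fg r (s<s xp))) (trans (cong (f r) e) f0)
  ... | ()

  σ : NatPerm n
  σ = record { f = λ x → f r (suc x) ∸ 1 ; g = λ x → g r (suc x) ∸ 1
    ; f< = λ {x} xp → ∸1< (n≢0⇒n>0 (f-suc≢0 xp)) (f< r (s<s xp))
    ; g< = λ {x} xp → ∸1< (n≢0⇒n>0 (g-suc≢0 xp)) (g< r (s<s xp))
    ; gf = λ {x} xp → trans (cong (λ z → g r z ∸ 1) (suc-∸1 (f-suc≢0 xp))) (cong (_∸ 1) (gf r (s<s xp)))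
    ; fg = λ {x} xp → trans (cong (λ z → f r z ∸ 1) (suc-∸1 (g-suc≢0 xp))) (cong (_∸ 1) (fg r (s<s xp))) }

  ncσ : NCInducedℕ n (f σ)
  ncσ = (λ x → B (suc x)) , noncrossing-window 1 B ≤-refl nc ,
        λ a ap → isNext-window 1 B a (f σ a) ≤-refl (subst (IsNextℕ (suc n) B (suc a)) (sym (suc-∸1 (f-suc≢0 ap))) (ind (suc a) (s<s ap)))

  matches : ∀ x → x < suc n → f r x ≡ glueℕ n 0 (f σ) (λ x → x) x
  matches zero xp = f0
  matches (suc x) xp = trans (sym (suc-∸1 (f-suc≢0 (s≤s⁻¹ xp)))) (sym (glueℕ-inner {n} {0} {f σ} {λ x → x} (s≤s⁻¹ xp)))

  decomposition : Decomposition n (f r)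
  decomposition = record { k = n ; m = 0 ; k+m≡n = +-identityʳ n ; σ = σ ; τ = emptyNatPerm ; ncσ = ncσ
               ; ncτ = (λ _ → 0) , (λ p q p' q' a b c ()) , (λ a ()) ; matches = matches }

-- If π(0) = k+1 then the block of 0 contains no point of [1, k], and by
-- noncrossing π maps [1, k] into itself and the rest into {0} ∪ [k+1, n].
module MovedZero {n} (r : NatPerm (suc n)) (B : ℕ → ℕ) (nc : NonCrossingℕ (suc n) B) (ind : Inducesℕ (suc n) B (f r)) (k : ℕ) (f0 : f r 0 ≡ suc k) where
  k<n : k < n
  k<n = s≤s⁻¹ (subst (_< suc n) f0 (f< r z<s))

  -- k+1 = π(0) is the successor of 0 in its block, so [1, k] misses that block.
  block-of-zero : B (suc k) ≡ B 0
  block-of-zero = subst (λ z → B z ≡ B 0) f0 (proj₁ (ind 0 z<s))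

  zero-block-gap : ∀ b → 0 < b → b < suc k → B b ≢ B 0
  zero-block-gap with ind 0 z<s
  ... | (_ , inj₁ (_ , btw)) = λ b p q → btw b p (subst (b <_) (sym f0) q)
  ... | (_ , inj₂ (le , _)) = ⊥-elim (<⇒≱ z<s (subst (_≤ 0) f0 le))

  inner-bound : ∀ {x} → x < suc k → x < suc n
  inner-bound xk = <-trans xk (s≤s k<n)

  -- π maps [1, k] into [1, k]: an image beyond k+1 would cross the block of 0.
  inner-image : ∀ {x} → 0 < x → x < suc k → 0 < f r x × f r x < suc k
  inner-image {x} x0 xk = n≢0⇒n>0 nz , lt (<-cmp (f r x) (suc k)) (proj₂ (ind x (inner-bound xk)))
    where
    eB : B (f r x) ≡ B x
    eB = proj₁ (ind x (inner-bound xk))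
    nz : f r x ≢ 0
    nz e = zero-block-gap x x0 xk (trans (sym eB) (cong B e))
    lt : Tri (f r x < suc k) (f r x ≡ suc k) (f r x > suc k) → _ → f r x < suc k
    lt (tri< a _ _) _ = a
    lt (tri≈ _ b _) _ = ⊥-elim (<⇒≢ x0 (sym (natPerm-injective r (inner-bound xk) z<s (trans b (sym f0)))))
    lt (tri> _ _ c) (inj₁ (_ , _)) = ⊥-elim (nc 0 x (suc k) (f r x) x0 xk c (f< r (inner-bound xk)) (sym block-of-zero) (sym eB) (λ e → zero-block-gap x x0 xk (sym e)))
    lt (tri> _ _ c) (inj₂ (le , _)) = ⊥-elim (<⇒≱ (<-trans xk c) le)

  outer-image : ∀ {x} → suc k ≤ x → x < suc n → f r x ≡ 0 ⊎ suc k ≤ f r x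
  outer-image {x} kx xp with f r x in eq
  ... | zero = inj₁ refl
  ... | suc v with suc k ≤? suc v
  ...   | yes q = inj₂ q
  ...   | no q = ⊥-elim (contra (m≤n⇒m<n∨m≡n kx))
    where
    y<k : suc v < suc k
    y<k = ≰⇒> q
    eB : B (suc v) ≡ B x
    eB = trans (cong B (sym eq)) (proj₁ (ind x xp))
    contra : suc k < x ⊎ suc k ≡ x → ⊥
    contra (inj₂ refl) = zero-block-gap (suc v) z<s y<k (trans eB block-of-zero)
    contra (inj₁ lt) = nc 0 (suc v) (suc k) x z<s y<k lt xp (sym block-of-zero) eB (λ e → zero-block-gap (suc v) z<s y<k (sym e))

  inner-preimage : ∀ {y} → 0 < y → y < suc k → 0 < g r y × g r y < suc k
  inner-preimage {y} y0 yk = n≢0⇒n>0 nz , lt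
    where
    yn = inner-bound yk
    fx : f r (g r y) ≡ y
    fx = fg r yn
    nz : g r y ≢ 0
    nz e = <⇒≱ yk (≤-reflexive (trans (sym f0) (trans (cong (f r) (sym e)) fx)))
    lt : g r y < suc k
    lt with g r y <? suc k
    ... | yes p = p
    ... | no p with outer-image (≮⇒≥ p) (g< r yn)
    ...   | inj₁ e = ⊥-elim (<⇒≢ y0 (sym (trans (sym fx) e)))
    ...   | inj₂ le = ⊥-elim (<⇒≱ yk (subst (suc k ≤_) fx le))

  outer-preimage : ∀ {y} → y < suc n → (y ≡ 0 ⊎ suc k < y) → suc k ≤ g r y
  outer-preimage {y} yn h with g r y <? suc k | g r y ≟ 0
  ... | no p | _ = ≮⇒≥ p
  ... | yes p | yes e with h
  ...   | inj₁ y0 = ⊥-elim (0≢1+n (trans (sym y0) (trans (sym (fg r yn)) (trans (cong (f r) e) f0))))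
  ...   | inj₂ ky = ⊥-elim (<⇒≢ ky (sym (trans (sym (fg r yn)) (trans (cong (f r) e) f0))))
  outer-preimage {y} yn h | yes p | no ne with inner-image (n≢0⇒n>0 ne) p | h
  ...   | (a , _) | inj₁ y0 = ⊥-elim (<⇒≢ a (sym (trans (fg r yn) y0)))
  ...   | (_ , b) | inj₂ ky = ⊥-elim (<-asym ky (subst (_< suc k) (fg r yn) b))

  m : ℕ
  m = n ∸ k

  k+m≡n : k + m ≡ n
  k+m≡n = m+[n∸m]≡n (<⇒≤ k<n)

  0<m : 0 < m
  0<m = m<n⇒0<n∸m k<n

  outer-bound : ∀ {y} → y < m → suc (k + y) < suc n
  outer-bound yp = s<s (subst (k + _ <_) k+m≡n (+-monoʳ-< k yp))

  outer-position : ∀ {x} → suc k ≤ x → x < suc n → Σ ℕ λ w → x ≡ suc (k + w) × w < m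
  outer-position {suc x} (s≤s kx) xp with position k x
  ... | below q = ⊥-elim (<⇒≱ q kx)
  ... | beyond w refl = w , refl , +-cancelˡ-< k w m (subst (k + w <_) (sym k+m≡n) (s≤s⁻¹ xp))

  τ-image : ∀ {y} → y < m → (f r (suc (k + y)) ≡ 0) ⊎ (Σ ℕ λ w → f r (suc (k + y)) ≡ suc (k + w) × 0 < w × w < m)
  τ-image {y} yp with outer-image (s≤s (m≤m+n k y)) (outer-bound yp)
  ... | inj₁ e = inj₁ e
  ... | inj₂ le with outer-position le (f< r (outer-bound yp))
  ...   | w , e , wm = inj₂ (w , e , n≢0⇒n>0 (λ w0 → 0≢1+n (natPerm-injective r z<s (outer-bound yp)
              (trans f0 (sym (trans e (trans (cong (λ z → suc (k + z)) w0) (cong suc (+-identityʳ k)))))))) , wm)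

  outer⁻¹-shift : ∀ w → outer⁻¹ k (suc (k + w)) ≡ w
  outer⁻¹-shift w = m+n∸m≡n k w

  preimage-outer : ∀ {x} → x < suc n → (x ≡ 0 ⊎ suc k < x) → Σ ℕ λ w → g r x ≡ suc (k + w) × w < m
  preimage-outer xp h = outer-position (outer-preimage xp h) (g< r xp)

  fσ : ℕ → ℕ
  fσ x = f r (suc x) ∸ 1

  gσ : ℕ → ℕ
  gσ x = g r (suc x) ∸ 1

  σ : NatPerm k
  σ = record { f = fσ ; g = gσ
    ; f< = λ {x} xp → ∸1< (proj₁ (inner-image z<s (s<s xp))) (proj₂ (inner-image z<s (s<s xp)))
    ; g< = λ {x} xp → ∸1< (proj₁ (inner-preimage z<s (s<s xp))) (proj₂ (inner-preimage z<s (s<s xp)))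
    ; gf = λ {x} xp → trans (cong (λ z → g r z ∸ 1) (suc-∸1 (λ e → <⇒≢ (proj₁ (inner-image z<s (s<s xp))) (sym e)))) (cong (_∸ 1) (gf r (inner-bound (s<s xp))))
    ; fg = λ {x} xp → trans (cong (λ z → f r z ∸ 1) (suc-∸1 (λ e → <⇒≢ (proj₁ (inner-preimage z<s (s<s xp))) (sym e)))) (cong (_∸ 1) (fg r (inner-bound (s<s xp)))) }

  fτ : ℕ → ℕ
  fτ y = outer⁻¹ k (f r (suc (k + y)))

  gτ : ℕ → ℕ
  gτ zero = g r 0 ∸ suc k
  gτ (suc y) = g r (suc (k + suc y)) ∸ suc k

  -- The point of [0, n] that stands for the value y of τ.
  valuePosition : ℕ → ℕ
  valuePosition zero = 0
  valuePosition (suc y) = suc (k + suc y)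

  gτ-eq : ∀ {y} → y < m → Σ ℕ λ w → g r (valuePosition y) ≡ suc (k + w) × w < m × gτ y ≡ w
  gτ-eq {zero} yp with preimage-outer {0} z<s (inj₁ refl)
  ... | w , e , wm = w , e , wm , trans (cong (_∸ suc k) e) (outer⁻¹-shift w)
  gτ-eq {suc y} yp with preimage-outer (outer-bound yp) (inj₂ (s≤s (≤-trans (s≤s (m≤m+n k y)) (≤-reflexive (sym (+-suc k y))))))
  ... | w , e , wm = w , e , wm , trans (cong (_∸ suc k) e) (outer⁻¹-shift w)

  τ : NatPerm m
  τ = record { f = fτ ; g = gτ ; f< = fτ< ; g< = gτ< ; gf = gfτ ; fg = fgτ }
    where
    fτ< : ∀ {y} → y < m → fτ y < m
    fτ< {y} yp with τ-image yp
    ... | inj₁ e rewrite e = 0<m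
    ... | inj₂ (w , e , _ , wm) rewrite e | outer⁻¹-shift w = wm
    gτ< : ∀ {y} → y < m → gτ y < m
    gτ< {y} yp with gτ-eq yp
    ... | w , _ , wm , e rewrite e = wm
    gfτ : ∀ {y} → y < m → gτ (fτ y) ≡ y
    gfτ {y} yp with τ-image yp
    ... | inj₁ e rewrite e = trans (cong (λ z → g r z ∸ suc k) (sym e)) (trans (cong (_∸ suc k) (gf r (outer-bound yp))) (outer⁻¹-shift y))
    ... | inj₂ (suc w' , e , _ , wm) rewrite e | outer⁻¹-shift (suc w') =
          trans (cong (λ z → g r z ∸ suc k) (sym e)) (trans (cong (_∸ suc k) (gf r (outer-bound yp))) (outer⁻¹-shift y))
    fgτ : ∀ {y} → y < m → fτ (gτ y) ≡ y
    fgτ {zero} yp with gτ-eq {zero} yp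
    ... | w , e , wm , ge rewrite ge = trans (cong (λ z → outer⁻¹ k (f r z)) (sym e)) (cong (outer⁻¹ k) (fg r z<s))
    fgτ {suc y} yp with gτ-eq {suc y} yp
    ... | w , e , wm , ge rewrite ge = trans (cong (λ z → outer⁻¹ k (f r z)) (sym e)) (trans (cong (outer⁻¹ k) (fg r (outer-bound yp))) (outer⁻¹-shift (suc y)))

  ncσ : NCInducedℕ k fσ
  ncσ = (λ x → B (suc x)) , noncrossing-window 1 B (s≤s (<⇒≤ k<n)) nc ,
        λ a ap → isNext-window 1 B a (fσ a) (s≤s (<⇒≤ k<n))
          (subst (IsNextℕ (suc n) B (suc a)) (sym (suc-∸1 (λ e → <⇒≢ (proj₁ (inner-image z<s (s<s ap))) (sym e)))) (ind (suc a) (inner-bound (s<s ap))))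

  bnd : suc k + m ≤ suc n
  bnd = ≤-reflexive (cong suc k+m≡n)

  ncτ : NCInducedℕ m fτ
  ncτ = (λ y → B (suc k + y)) , noncrossing-window (suc k) B bnd nc , indτ
    where
    indτ : Inducesℕ m (λ y → B (suc k + y)) fτ
    indτ a ap with τ-image ap | ind (suc (k + a)) (outer-bound ap)
    ... | inj₁ e | (eB , rest) rewrite e = trans (cong B (cong suc (+-identityʳ k))) (trans block-of-zero eB) , go rest
      where
      go : _ → _
      go (inj₁ (lt , _)) = ⊥-elim (<⇒≱ lt z≤n)
      go (inj₂ (_ , aft , _)) = inj₂ (z≤n , (λ b ab bm → aft (suc (k + b)) (s<s (+-monoʳ-< k ab)) (outer-bound bm)) , λ b ())
    ... | inj₂ (w , e , _ , wm) | _ = subst (IsNextℕ m (λ y → B (suc k + y)) a) (sym (trans (cong (outer⁻¹ k) e) (outer⁻¹-shift w)))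
          (isNext-window (suc k) B a w bnd (subst (IsNextℕ (suc n) B (suc (k + a))) e (ind (suc (k + a)) (outer-bound ap))))

  glueℕ-zero : ∀ m' (ff gg : ℕ → ℕ) → 0 < m' → glueℕ k m' ff gg 0 ≡ suc k
  glueℕ-zero (suc m') ff gg _ = refl

  matches : ∀ x → x < suc n → f r x ≡ glueℕ k m fσ fτ x
  matches zero xp = trans f0 (sym (glueℕ-zero m fσ fτ 0<m))
  matches (suc x) xp with position k x
  ... | below q = trans (sym (suc-∸1 (λ e → <⇒≢ (proj₁ (inner-image z<s (s<s q))) (sym e)))) (sym (glueℕ-inner {k} {m} {fσ} {fτ} q))
  ... | beyond z refl with τ-image (+-cancelˡ-< k z m (subst (k + z <_) (sym k+m≡n) (s≤s⁻¹ xp)))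
  ...   | inj₁ e rewrite glueℕ-outer {k} {m} {fσ} {fτ} z | e = refl
  ...   | inj₂ (w , e , w0 , _) rewrite glueℕ-outer {k} {m} {fσ} {fτ} z | e | outer⁻¹-shift w = lem w w0
    where
    lem : ∀ w → 0 < w → suc (k + w) ≡ outer k w
    lem (suc w) _ = cong suc (+-comm k (suc w))

  decomposition : Decomposition n (f r)
  decomposition = record { k = k ; m = m ; k+m≡n = k+m≡n ; σ = σ ; τ = τ ; ncσ = ncσ ; ncτ = ncτ ; matches = matches }

decompose : ∀ {n} (r : NatPerm (suc n)) → NCInducedℕ (suc n) (f r) → Decomposition n (f r)
decompose r (B , nc , ind) with f r 0 in e
... | zero = FixedZero.decomposition r B nc ind e
... | suc k = MovedZero.decomposition r B nc ind k e

glueℕ-cong : ∀ {k m} {f1 f2 g1 g2 : ℕ → ℕ} → (∀ x → x < k → f1 x ≡ f2 x) → (∀ x → x < m → g1 x ≡ g2 x) →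
             ∀ x → x < suc (k + m) → glueℕ k m f1 g1 x ≡ glueℕ k m f2 g2 x
glueℕ-cong {k} {zero} hf hg zero xp = refl
glueℕ-cong {k} {suc m} hf hg zero xp = refl
glueℕ-cong {k} {m} {f1} {f2} {g1} {g2} hf hg (suc x) xp with position k x
... | below q rewrite glueℕ-inner {k} {m} {f1} {g1} q | glueℕ-inner {k} {m} {f2} {g2} q = cong suc (hf x q)
... | beyond z refl rewrite glueℕ-outer {k} {m} {f1} {g1} z | glueℕ-outer {k} {m} {f2} {g2} z =
      cong (outer k) (hg z (+-cancelˡ-< k z m (s≤s⁻¹ xp)))

⟦⟧-glue′ : ∀ {ka ma} (σ : Permutation′ ka) (τ : Permutation′ ma) k m → ka ≡ k → ma ≡ m →
         ∀ x → x < suc (k + m) → ⟦ glue σ τ ⟧ x ≡ glueℕ k m ⟦ σ ⟧ ⟦ τ ⟧ x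
⟦⟧-glue′ σ τ k m refl refl x xp = ⟦⟧-glue σ τ x xp

-- Repeated decomposition: every noncrossing-induced permutation agrees
-- with treePerm of some tree (induction on n, bounded by the fuel N).
ncInducedℕ⇒tree : ∀ N {n} → n ≤ N → (r : NatPerm n) → NCInducedℕ n (f r) →
                  Σ Tree λ t → size t ≡ n × (∀ x → x < n → f r x ≡ ⟦ treePerm t ⟧ x)
ncInducedℕ⇒tree N {zero} _ r _ = leaf , refl , λ x ()
ncInducedℕ⇒tree (suc N) {suc n} n≤N r nci = node (proj₁ left) (proj₁ right) , size≡ , agree
  where
  open Decomposition (decompose r nci)
  k+m≤N : k + m ≤ N
  k+m≤N = ≤-trans (≤-reflexive k+m≡n) (s≤s⁻¹ n≤N)
  left : Σ Tree λ t → size t ≡ k × (∀ x → x < k → f σ x ≡ ⟦ treePerm t ⟧ x)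
  left = ncInducedℕ⇒tree N (≤-trans (m≤m+n k m) k+m≤N) σ ncσ
  right : Σ Tree λ t → size t ≡ m × (∀ x → x < m → f τ x ≡ ⟦ treePerm t ⟧ x)
  right = ncInducedℕ⇒tree N (≤-trans (m≤n+m m k) k+m≤N) τ ncτ
  size≡ : suc (size (proj₁ left) + size (proj₁ right)) ≡ suc n
  size≡ = cong suc (trans (cong₂ _+_ (proj₁ (proj₂ left)) (proj₁ (proj₂ right))) k+m≡n)
  agree : ∀ x → x < suc n → f r x ≡ ⟦ glue (treePerm (proj₁ left)) (treePerm (proj₁ right)) ⟧ x
  agree x x<1+n = trans (matches x x<1+n) (trans (glueℕ-cong (proj₂ (proj₂ left)) (proj₂ (proj₂ right)) x x<1+k+m)
                    (sym (⟦⟧-glue′ (treePerm (proj₁ left)) (treePerm (proj₁ right)) k m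
                                   (proj₁ (proj₂ left)) (proj₁ (proj₂ right)) x x<1+k+m)))
    where x<1+k+m = subst (λ z → x < suc z) (sym k+m≡n) x<1+n

tree⇒reducible : ∀ t {n} (e : size t ≡ n) (π : Permutation′ n) → (∀ x → x < n → ⟦ π ⟧ x ≡ ⟦ treePerm t ⟧ x) → Reducible π
tree⇒reducible t refl π h = reducible-resp (λ x xp → sym (h x xp)) (reducible₁₃⇒reducible (reducible₁₃-tree t))

ncInducedℕ⇒reducible : ∀ {n} (π : Permutation′ n) → NCInducedℕ n ⟦ π ⟧ → Reducible π
ncInducedℕ⇒reducible {n} π nci with ncInducedℕ⇒tree n ≤-refl (toNatPerm π) nci
... | t , e , h = tree⇒reducible t e π h

-- Different trees give different permutations: the glue determines the
-- sizes of its two parts (via the image of 0) and the two parts.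
outer-injective : ∀ k {y1 y2} → outer k y1 ≡ outer k y2 → y1 ≡ y2
outer-injective k {zero} {zero} e = refl
outer-injective k {suc y1} {suc y2} e = +-cancelʳ-≡ k (suc y1) (suc y2) (suc-injective e)

glue-injective : ∀ {k m k' m'} (σ : Permutation′ k) (τ : Permutation′ m) (σ' : Permutation′ k') (τ' : Permutation′ m') →
          suc (k + m) ≡ suc (k' + m') →
          (∀ x → x < suc (k + m) → glueℕ k m ⟦ σ ⟧ ⟦ τ ⟧ x ≡ glueℕ k' m' ⟦ σ' ⟧ ⟦ τ' ⟧ x) →
          (k ≡ k') × (m ≡ m') × (∀ x → x < k → ⟦ σ ⟧ x ≡ ⟦ σ' ⟧ x) × (∀ y → y < m → ⟦ τ ⟧ y ≡ ⟦ τ' ⟧ y)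
glue-injective {k} {m} {k'} {m'} σ τ σ' τ' e h with keq m m' (h 0 z<s)
  where
  keq : ∀ m m' → glueℕ k m ⟦ σ ⟧ ⟦ τ ⟧ 0 ≡ glueℕ k' m' ⟦ σ' ⟧ ⟦ τ' ⟧ 0 → k ≡ k' ⊎ (m ≡ 0 × m' ≡ 0)
  keq zero zero _ = inj₂ (refl , refl)
  keq (suc _) (suc _) e = inj₁ (suc-injective e)
... | inj₂ (refl , refl) = fin (+-cancelʳ-≡ 0 k k' (suc-injective e))
  where
  fin : k ≡ k' → _
  fin refl = refl , refl , (λ x q → suc-injective (trans (sym (glueℕ-inner {k} {0} {⟦ σ ⟧} {⟦ τ ⟧} q)) (trans (h (suc x) (s<s (≤-trans q (m≤m+n k 0)))) (glueℕ-inner {k} {0} {⟦ σ' ⟧} {⟦ τ' ⟧} q)))) , λ y ()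
... | inj₁ refl = fin (+-cancelˡ-≡ k m m' (suc-injective e))
  where
  fin : m ≡ m' → _
  fin refl = refl , refl , (λ x q → suc-injective (trans (sym (glueℕ-inner {k} {m} {⟦ σ ⟧} {⟦ τ ⟧} q)) (trans (h (suc x) (s<s (≤-trans q (m≤m+n k m)))) (glueℕ-inner {k} {m} {⟦ σ' ⟧} {⟦ τ' ⟧} q)))) ,
    λ y q → outer-injective k (trans (sym (glueℕ-outer {k} {m} {⟦ σ ⟧} {⟦ τ ⟧} y)) (trans (h (suc (k + y)) (s<s (+-monoʳ-< k q))) (glueℕ-outer {k} {m} {⟦ σ' ⟧} {⟦ τ' ⟧} y)))

treePerm-injective : ∀ t t' → size t ≡ size t' → (∀ x → x < size t → ⟦ treePerm t ⟧ x ≡ ⟦ treePerm t' ⟧ x) → t ≡ t'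
treePerm-injective leaf leaf e h = refl
treePerm-injective (node a b) (node a' b') e h with glue-injective (treePerm a) (treePerm b) (treePerm a') (treePerm b') e
    (λ x xp → trans (sym (⟦⟧-glue (treePerm a) (treePerm b) x xp)) (trans (h x xp) (⟦⟧-glue (treePerm a') (treePerm b') x (subst (x <_) e xp))))
... | ek , em , ha , hb = cong₂ node (treePerm-injective a a' ek ha) (treePerm-injective b b' em hb)

-- Trees with n nodes are enumerated through forests:
-- forests n r lists every r-tuple of trees with n nodes in total, exactly
-- once, by looking at the first tree (a leaf, or a node whose two subtrees
-- are grafted back into the tuple).
forestSize : ∀ {r} → Vec Tree r → ℕ
forestSize [] = 0
forestSize (t ∷ ts) = size t + forestSize ts

graft : ∀ {r} → Vec Tree (suc (suc r)) → Vec Tree (suc r)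
graft (a ∷ b ∷ ts) = node a b ∷ ts

forests : ℕ → (r : ℕ) → List (Vec Tree r)
forests zero zero = [ [] ]
forests (suc n) zero = []
forests zero (suc r) = map (leaf ∷_) (forests zero r)
forests (suc n) (suc r) = map (leaf ∷_) (forests (suc n) r) ++ map graft (forests n (suc (suc r)))

forestCount : ℕ → ℕ → ℕ
forestCount zero zero = 1
forestCount (suc n) zero = 0
forestCount zero (suc r) = forestCount zero r
forestCount (suc n) (suc r) = forestCount (suc n) r + forestCount n (suc (suc r))

forests-length : ∀ n r → length (forests n r) ≡ forestCount n r
forests-length zero zero = refl
forests-length (suc n) zero = refl
forests-length zero (suc r) = trans (length-map _ (forests zero r)) (forests-length zero r)
forests-length (suc n) (suc r) = trans (length-++ (map (leaf ∷_) (forests (suc n) r)))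
  (cong₂ _+_ (trans (length-map _ (forests (suc n) r)) (forests-length (suc n) r)) (trans (length-map _ (forests n (suc (suc r)))) (forests-length n (suc (suc r)))))

forestSize-graft : ∀ {r} (v : Vec Tree (suc (suc r))) → forestSize (graft v) ≡ suc (forestSize v)
forestSize-graft (a ∷ b ∷ ts) = cong suc (+-assoc (size a) (size b) (forestSize ts))

forests-size : ∀ n r → All (λ v → forestSize v ≡ n) (forests n r)
forests-size zero zero = refl ∷ []
forests-size (suc n) zero = []
forests-size zero (suc r) = AllP.map⁺ (forests-size zero r)
forests-size (suc n) (suc r) = AllP.++⁺ (AllP.map⁺ (forests-size (suc n) r))
                                  (AllP.map⁺ (All.map (λ {v} e → trans (forestSize-graft v) (cong suc e)) (forests-size n (suc (suc r)))))

forests-complete : ∀ n r (v : Vec Tree r) → forestSize v ≡ n → v ∈ forests n r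
forests-complete zero zero [] e = here refl
forests-complete zero (suc r) (leaf ∷ v) e = ∈-map⁺ (leaf ∷_) (forests-complete zero r v e)
forests-complete (suc n) (suc r) (leaf ∷ v) e = ∈-++⁺ˡ (∈-map⁺ (leaf ∷_) (forests-complete (suc n) r v e))
forests-complete (suc n) (suc r) (node a b ∷ v) e = ∈-++⁺ʳ (map (leaf ∷_) (forests (suc n) r))
  (∈-map⁺ graft (forests-complete n (suc (suc r)) (a ∷ b ∷ v) (trans (sym (+-assoc (size a) (size b) (forestSize v))) (suc-injective e))))

leaf∷-injective : ∀ {r} {v w : Vec Tree r} → _≡_ {A = Vec Tree (suc r)} (leaf ∷ v) (leaf ∷ w) → v ≡ w
leaf∷-injective refl = refl

graft-injective : ∀ {r} {v w : Vec Tree (suc (suc r))} → graft v ≡ graft w → v ≡ w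
graft-injective {v = a ∷ b ∷ ts} {a' ∷ b' ∷ ts'} refl = refl

leaf∷-graft-disjoint : ∀ {r} (xs : List (Vec Tree r)) (ys : List (Vec Tree (suc (suc r)))) {v} → (v ∈ map (leaf ∷_) xs × v ∈ map graft ys) → ⊥
leaf∷-graft-disjoint xs ys (p , q) with ∈-map⁻ (leaf ∷_) p | ∈-map⁻ graft q
... | x , _ , refl | (a ∷ b ∷ ts) , _ , ()

forests-unique : ∀ n r → Unique (forests n r)
forests-unique zero zero = [] AP.∷ AP.[]
forests-unique (suc n) zero = AP.[]
forests-unique zero (suc r) = UP.map⁺ leaf∷-injective (forests-unique zero r)
forests-unique (suc n) (suc r) = UP.++⁺ (UP.map⁺ leaf∷-injective (forests-unique (suc n) r)) (UP.map⁺ graft-injective (forests-unique n (suc (suc r)))) (leaf∷-graft-disjoint (forests (suc n) r) (forests n (suc (suc r))))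

forestCount-empty : ∀ r → forestCount 0 r ≡ 1
forestCount-empty zero = refl
forestCount-empty (suc r) = forestCount-empty r

forestCount-closed : ∀ n r → forestCount n (suc r) * (n ! * (n + suc r) !) ≡ suc r * (n + n + r) !
forestCount-closed zero r rewrite forestCount-empty r = unit (suc r * r !)
  where
  unit : ∀ x → 1 * (1 * x) ≡ x
  unit = solve-∀
forestCount-closed (suc n) zero =
  begin
    forestCount n 2 * (suc n ! * (suc n + 1) !)
  ≡⟨ cong (λ z → forestCount n 2 * (suc n ! * z !)) (index₁ n) ⟩
    forestCount n 2 * (suc n * n ! * (n + 2) !)
  ≡⟨ pull-out (forestCount n 2) n (n !) ((n + 2) !) ⟩
    suc n * (forestCount n 2 * (n ! * (n + 2) !))
  ≡⟨ cong (suc n *_) (forestCount-closed n 1) ⟩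
    suc n * (2 * (n + n + 1) !)
  ≡⟨ combine n ((n + n + 1) !) ⟩
    1 * (suc (n + n + 1) !)
  ≡⟨ cong (λ z → 1 * z !) (sym (index₂ n)) ⟩
    1 * (suc n + suc n + 0) !
  ∎
  where
  open ≡-Reasoning
  index₁ : ∀ n → suc n + 1 ≡ n + 2
  index₁ = solve-∀
  index₂ : ∀ n → suc n + suc n + 0 ≡ suc (n + n + 1)
  index₂ = solve-∀
  pull-out : ∀ c n a b → c * (suc n * a * b) ≡ suc n * (c * (a * b))
  pull-out = solve-∀
  combine : ∀ n X → suc n * (2 * X) ≡ 1 * (suc (n + n + 1) * X)
  combine = solve-∀
forestCount-closed (suc n) (suc r) =
  begin
    (A + C) * (suc n ! * (suc n + suc (suc r)) !)
  ≡⟨ cong (λ z → (A + C) * (suc n ! * z !)) (index₁ n r) ⟩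
    (A + C) * (suc n * n ! * (suc N * N !))
  ≡⟨ distribute A C n (n !) (N !) N ⟩
    suc N * (A * (suc n * n ! * N !)) + suc n * (C * (n ! * (suc N * N !)))
  ≡⟨ cong₂ (λ u v → suc N * u + suc n * v) (forestCount-closed (suc n) r) C-closed ⟩
    suc N * (suc r * X) + suc n * (suc (suc (suc r)) * X)
  ≡⟨ combine n r X ⟩
    suc (suc r) * (suc (suc n + suc n + r) * X)
  ≡⟨ cong (λ z → suc (suc r) * z !) (sym (index₄ n r)) ⟩
    suc (suc r) * (suc n + suc n + suc r) !
  ∎
  where
  open ≡-Reasoning
  A = forestCount (suc n) (suc r)
  C = forestCount n (suc (suc (suc r)))
  N = suc n + suc r
  X = (suc n + suc n + r) !
  index₁ : ∀ n r → suc n + suc (suc r) ≡ suc (suc n + suc r)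
  index₁ = solve-∀
  index₂ : ∀ n r → n + suc (suc (suc r)) ≡ suc (suc n + suc r)
  index₂ = solve-∀
  index₃ : ∀ n r → n + n + suc (suc r) ≡ suc n + suc n + r
  index₃ = solve-∀
  index₄ : ∀ n r → suc n + suc n + suc r ≡ suc (suc n + suc n + r)
  index₄ = solve-∀
  distribute : ∀ A C n a x N → (A + C) * (suc n * a * (suc N * x)) ≡ suc N * (A * (suc n * a * x)) + suc n * (C * (a * (suc N * x)))
  distribute = solve-∀
  combine : ∀ n r X → suc (suc n + suc r) * (suc r * X) + suc n * (suc (suc (suc r)) * X) ≡ suc (suc r) * (suc (suc n + suc n + r) * X)
  combine = solve-∀
  C-closed : C * (n ! * (suc N) !) ≡ suc (suc (suc r)) * X
  C-closed = begin
      C * (n ! * (suc N) !)                  ≡⟨ cong (λ z → C * (n ! * z !)) (sym (index₂ n r)) ⟩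
      C * (n ! * (n + suc (suc (suc r))) !)  ≡⟨ forestCount-closed n (suc (suc r)) ⟩
      suc (suc (suc r)) * (n + n + suc (suc r)) !  ≡⟨ cong (λ z → suc (suc (suc r)) * z !) (index₃ n r) ⟩
      suc (suc (suc r)) * X                  ∎

forestCount≡catalan : ∀ n → forestCount n 1 ≡ catalan n
forestCount≡catalan n = sym (trans (cong (λ z → _/_ z D {{D≢0}}) (2n!≡count*D)) (m*n/n≡m (forestCount n 1) D {{D≢0}}))
  where
  D = n ! * (suc n) !
  D≢0 = n !* (suc n) !≢0
  index : ∀ n → n + 1 ≡ suc n
  index = solve-∀
  unit : ∀ x → 1 * x ≡ x
  unit = solve-∀
  double : ∀ n → n + n + 0 ≡ 2 * n
  double = solve-∀
  2n!≡count*D : (2 * n) ! ≡ forestCount n 1 * D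
  2n!≡count*D = sym (trans (cong (λ z → forestCount n 1 * (n ! * z !)) (sym (index n)))
                    (trans (forestCount-closed n 0) (trans (unit _) (cong _! (double n)))))

singleTree : Vec Tree 1 → Tree
singleTree (t ∷ []) = t

singleTree-injective : ∀ {v w} → singleTree v ≡ singleTree w → v ≡ w
singleTree-injective {t ∷ []} {.t ∷ []} refl = refl

trees : ℕ → List Tree
trees n = map singleTree (forests n 1)

trees-size : ∀ n → All (λ t → size t ≡ n) (trees n)
trees-size n = AllP.map⁺ (All.map (λ { {t ∷ []} e → trans (sym (+-identityʳ (size t))) e }) (forests-size n 1))

trees-complete : ∀ n t → size t ≡ n → t ∈ trees n
trees-complete n t e = ∈-map⁺ singleTree (forests-complete n 1 (t ∷ []) (trans (+-identityʳ (size t)) e))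

trees-unique : ∀ n → Unique (trees n)
trees-unique n = UP.map⁺ singleTree-injective (forests-unique n 1)

trees-length : ∀ n → length (trees n) ≡ catalan n
trees-length n = trans (length-map singleTree (forests n 1)) (trans (forests-length n 1) (forestCount≡catalan n))

⟦⟧-subst : ∀ {a b} (e : a ≡ b) (π : Permutation′ a) x → ⟦ subst Permutation′ e π ⟧ x ≡ ⟦ π ⟧ x
⟦⟧-subst refl π x = refl

-- treePerm t as an element of S_n; only used for trees of size n, the
-- identity otherwise.
treePermAt : (n : ℕ) → Tree → Permutation′ n
treePermAt n t with size t ≟ n
... | yes e = subst Permutation′ e (treePerm t)
... | no _ = Perm.id

⟦⟧-treePermAt : ∀ n t → size t ≡ n → ∀ x → ⟦ treePermAt n t ⟧ x ≡ ⟦ treePerm t ⟧ x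
⟦⟧-treePermAt n t e x with size t ≟ n
... | yes e' = ⟦⟧-subst e' (treePerm t) x
... | no ne = ⊥-elim (ne e)

≈ₚ⇒⟦⟧ : ∀ {n} {π ρ : Permutation′ n} → π ≈ₚ ρ → ∀ x → x < n → ⟦ π ⟧ x ≡ ⟦ ρ ⟧ x
≈ₚ⇒⟦⟧ {n} {π} {ρ} h x p = trans (⟦⟧-fromℕ< π x p) (trans (cong toℕ (h _)) (sym (⟦⟧-fromℕ< ρ x p)))

⟦⟧⇒≈ₚ : ∀ {n} {π ρ : Permutation′ n} → (∀ x → x < n → ⟦ π ⟧ x ≡ ⟦ ρ ⟧ x) → π ≈ₚ ρ
⟦⟧⇒≈ₚ {n} {π} {ρ} h i = toℕ-injective (trans (sym (⟦⟧-toℕ π i)) (trans (h (toℕ i) (toℕ<n i)) (⟦⟧-toℕ ρ i)))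

allPairs-strengthen : ∀ {A : Set} {P : A → Set} {R S : A → A → Set} {xs} → All P xs → AllPairs R xs →
                      (∀ {x y} → P x → P y → R x y → S x y) → AllPairs S xs
allPairs-strengthen [] [] h = []
allPairs-strengthen {P = P} {R} {S} (px ∷ pxs) (rx ∷ rxs) h = pointwise pxs rx ∷ allPairs-strengthen pxs rxs h
  where
  pointwise : ∀ {ys} → All P ys → All (R _) ys → All (S _) ys
  pointwise [] [] = []
  pointwise (py ∷ pys) (r ∷ rs) = h px py r ∷ pointwise pys rs

reducible⇔ncInduced : ∀ {n} (π : Permutation′ n) → Reducible π ⇔ NCInduced π
reducible⇔ncInduced π = mk⇔ (λ r → ncInducedℕ⇒ π (reducible⇒ncInducedℕ r))
                            (λ nc → ncInducedℕ⇒reducible π (ncInduced⇒ℕ π nc))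

reducible-count : ∀ n → HasCount n Reducible (catalan n)
reducible-count n = perms , trans (length-map (treePermAt n) (trees n)) (trees-length n) , distinct , reducible , complete
  where
  perms : List (Permutation′ n)
  perms = map (treePermAt n) (trees n)
  distinct : AllPairs (λ π ρ → ¬ (π ≈ₚ ρ)) perms
  distinct = APP.map⁺ (allPairs-strengthen (trees-size n) (trees-unique n)
    λ {t} {t'} e e' t≢t' π≈ρ → t≢t' (treePerm-injective t t' (trans e (sym e'))
      (λ x p → trans (sym (⟦⟧-treePermAt n t e x)) (trans (≈ₚ⇒⟦⟧ π≈ρ x (subst (x <_) e p)) (⟦⟧-treePermAt n t' e' x)))))
  reducible : All Reducible perms
  reducible = AllP.map⁺ (All.map (λ {t} e → tree⇒reducible t e (treePermAt n t) (λ x _ → ⟦⟧-treePermAt n t e x)) (trees-size n))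
  complete : ∀ π → Reducible π → Any (π ≈ₚ_) perms
  complete π r with ncInducedℕ⇒tree n ≤-refl (toNatPerm π) (reducible⇒ncInducedℕ r)
  ... | t , e , h = AnyP.map⁺ (Any.map (λ { refl → ⟦⟧⇒≈ₚ λ x p → trans (h x p) (sym (⟦⟧-treePermAt n t e x)) }) (trees-complete n t e))

lemma10 : (n : ℕ) →
    ((π : Permutation′ n) → Reducible π ⇔ NCInduced π) ×
    HasCount n Reducible (catalan n)
lemma10 n = reducible⇔ncInduced , reducible-count n
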